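{- We have $$G^+_{123}(x)=\frac{x^3(1+x^2)}{(1-x^2)^2}\qquad\text{and}\qquad G^-_{123}(x)=\frac{x^3(1-x^2)}{(1+x^2)^2}.$$
   Context: A subsequence has type $\sigma$ if it has the same relative order as $\sigma$. For a permutation $\pi$, $I(3412;\pi)$ is the set of involutions of any length that avoid $3412$ and contain exactly one subsequence of type $\pi$. Then $G^+_\pi(x)=\sum_{\sigma\in I(3412;\pi)}x^{|\sigma|}$ and $G^-_\pi(x)=\sum_{\sigma\in I(3412;\pi)}\operatorname{sign}(\sigma)x^{|\sigma|}$, where $\operatorname{sign}(\sigma)=\pm1$ is the sign of $\sigma$. -}

module Defs where

open import Data.Bool using (Bool; true; false; _∧_; _∨_; not; _xor_; if_then_else_)
open import Data.Nat as ℕ using (ℕ; zero; suc; _<ᵇ_; _≡ᵇ_)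
open import Data.Fin using (Fin; toℕ; #_)
open import Data.Vec using (Vec; []; _∷_; lookup)
open import Data.List using (List; []; _∷_; map; concatMap; allFin; filterᵇ; length; foldr)
open import Data.Bool.ListAction using (all)
open import Data.Integer using (ℤ; +_; _+_; _*_; -_)

-- Permutations of length n in one-line notation (values 0..n-1, 0-based).
Perm : ℕ → Set
Perm n = Vec (Fin n) n

allVecs : (n k : ℕ) → List (Vec (Fin k) n)
allVecs zero    k = [] ∷ []
allVecs (suc n) k = concatMap (λ v → map (_∷ v) (allFin k)) (allVecs n k)

allPairs : {n : ℕ} → (Fin n → Fin n → Bool) → Bool
allPairs {n} f = all (λ i → all (λ j → f i j) (allFin n)) (allFin n)

-- a word of length n over Fin n is a permutation iff it is injective
isPerm : {n : ℕ} → Vec (Fin n) n → Bool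
isPerm π = allPairs (λ i j → (toℕ i ≡ᵇ toℕ j) ∨ not (toℕ (lookup π i) ≡ᵇ toℕ (lookup π j)))

isInvolution : {n : ℕ} → Perm n → Bool
isInvolution {n} π = all (λ i → toℕ (lookup π (lookup π i)) ≡ᵇ toℕ i) (allFin n)

increasing : {m n : ℕ} → Vec (Fin n) m → Bool
increasing idx = allPairs (λ a b → not (toℕ a <ᵇ toℕ b) ∨ (toℕ (lookup idx a) <ᵇ toℕ (lookup idx b)))

hasType : {m n : ℕ} → Perm m → Perm n → Vec (Fin n) m → Bool
hasType σ π idx = allPairs (λ a b →
  not ((toℕ (lookup π (lookup idx a)) <ᵇ toℕ (lookup π (lookup idx b)))
       xor (toℕ (lookup σ a) <ᵇ toℕ (lookup σ b))))

occurrences : {m n : ℕ} → Perm m → Perm n → ℕ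
occurrences {m} {n} σ π = length (filterᵇ (λ idx → increasing idx ∧ hasType σ π idx) (allVecs m n))

p123 : Perm 3
p123 = # 0 ∷ # 1 ∷ # 2 ∷ []

p3412 : Perm 4
p3412 = # 2 ∷ # 3 ∷ # 0 ∷ # 1 ∷ []

I3412-123 : (n : ℕ) → List (Perm n)
I3412-123 n = filterᵇ (λ π → isPerm π ∧ isInvolution π
                          ∧ (occurrences p3412 π ≡ᵇ 0) ∧ (occurrences p123 π ≡ᵇ 1))
                      (allVecs n n)

evenᵇ : ℕ → Bool
evenᵇ zero    = true
evenᵇ (suc k) = not (evenᵇ k)

inversions : {n : ℕ} → Perm n → ℕ
inversions {n} π = length (filterᵇ (λ ij → ij) 
  (concatMap (λ i → map (λ j → (toℕ i <ᵇ toℕ j) ∧ (toℕ (lookup π j) <ᵇ toℕ (lookup π i))) (allFin n)) (allFin n)))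

sign : {n : ℕ} → Perm n → ℤ
sign π = if evenᵇ (inversions π) then + 1 else - (+ 1)

gPlus : ℕ → ℤ
gPlus n = + length (I3412-123 n)

gMinus : ℕ → ℤ
gMinus n = foldr (λ π acc → sign π + acc) (+ 0) (I3412-123 n)

-- polynomials as coefficient lists (constant term first)
Poly : Set
Poly = List ℤ

padd : Poly → Poly → Poly
padd []       q        = q
padd p        []       = p
padd (a ∷ p)  (b ∷ q)  = (a + b) ∷ padd p q

pmul : Poly → Poly → Poly
pmul []      q = []
pmul (a ∷ p) q = padd (map (a *_) q) (+ 0 ∷ pmul p q)

pconst : ℤ → Poly
pconst a = a ∷ []

X : Poly
X = + 0 ∷ + 1 ∷ []

ppow : Poly → ℕ → Poly
ppow p zero    = pconst (+ 1)
ppow p (suc k) = pmul p (ppow p k)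

coeff : Poly → ℕ → ℤ
coeff []      n       = + 0
coeff (a ∷ p) zero    = a
coeff (a ∷ p) (suc n) = coeff p n

-- n-th coefficient of (polynomial) × (formal power series given by coefficients f)
mulPS : Poly → (ℕ → ℤ) → ℕ → ℤ
mulPS []      f n       = + 0
mulPS (a ∷ p) f zero    = a * f zero
mulPS (a ∷ p) f (suc n) = a * f (suc n) + mulPS p f n

-- An involution π of {0, …, n − 1} with exactly one 123 and no 3412 either starts with n − 1,
-- or fixes 0, or fixes n − 1: otherwise the letters 0 and n − 1, sitting at positions j = π(0)
-- and k = π(n − 1), let every candidate occurrence of 123 be shifted to a second one.  If
-- π(0) = n − 1 then π(n − 1) = 0 and removing both ends leaves such an involution of length
-- n − 2.  If π(0) = 0, each ascent i < j with i > 0 extends to the occurrence 0 i j, so there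
-- is exactly one such ascent; this forces n = 2p + 1 and π = 1 ⊕ δ, where δ reverses
-- {1, …, 2p} but fixes p and p + 1.  Fixing n − 1 is the reverse-complement case, δ ⊕ 1.
-- So the count a and the signed count s satisfy a(n + 2) = a(n) + e(n + 2) and
-- s(n + 2) = −s(n) + e±(n + 2), since wrapping adds 2n + 1 inversions, where e(3) = e±(3) = 1
-- and, for odd n ≥ 5, e(n) = 2 and e±(n + 2) = −e±(n).  Multiplying by (1 − x²)² resp.
-- (1 + x²)² turns these recurrences into the two identities.

module Submission where

open import Defs
open import Data.Bool using (Bool; true; false; _∧_; _∨_; not; _xor_; T; if_then_else_)
open import Data.Bool.Properties using (T-∧; T-≡; T-not-≡; not-involutive)
open import Data.Bool.ListAction using (all)
open import Data.Empty using (⊥; ⊥-elim)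
open import Data.Fin using (Fin; toℕ; fromℕ; fromℕ<; inject₁) renaming (zero to fz; suc to fs)
open import Data.Fin.Properties using (toℕ-injective; toℕ<n; toℕ-fromℕ; toℕ-fromℕ<; toℕ-inject₁)
open import Data.Integer using (ℤ; +_; -_; -[1+_]) renaming (_+_ to _+ℤ_; _*_ to _*ℤ_)
import Data.Integer.Properties as ℤ
import Data.Integer.Tactic.RingSolver as ℤ-Solver
open import Data.List using (List; []; _∷_; _++_; map; allFin; filterᵇ; length; cartesianProductWith)
import Data.List as List
open import Data.List.Membership.Propositional using (_∈_; lose)
open import Data.List.Membership.Propositional.Properties
  using (∈-allFin; ∈-cartesianProductWith⁺; ∈-filter⁺; ∈-filter⁻; ∈-map⁺; ∈-map⁻; ∈-++⁺ˡ; ∈-++⁺ʳ; ∈-++⁻)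
open import Data.List.Membership.Propositional.Properties.WithK using (unique∧set⇒bag)
open import Data.List.Properties using (filter-some; filter-none; length-++; length-map)
open import Data.List.Relation.Binary.BagAndSetEquality using (∼bag⇒↭)
open import Data.List.Relation.Binary.Permutation.Propositional as ↭ using (_↭_)
open import Data.List.Relation.Binary.Permutation.Propositional.Properties using (↭-length)
open import Data.List.Relation.Unary.All as All using (All)
open import Data.List.Relation.Unary.All.Properties using (all⁺; all⁻; tabulate⁺; tabulate⁻)
open import Data.List.Relation.Unary.AllPairs using ([]; _∷_)
open import Data.List.Relation.Unary.Any using (here; there)
open import Data.List.Relation.Unary.Unique.Propositional using (Unique)
open import Data.List.Relation.Unary.Unique.Propositional.Properties
  using (allFin⁺; cartesianProductWith⁺; filter⁺; ++⁺; map⁺)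
open import Data.Nat using (ℕ; zero; suc; pred; _+_; _∸_; _<_; _≤_; z≤n; s≤s; s≤s⁻¹; _<ᵇ_; _≡ᵇ_)
open import Data.Nat.Induction using (<-rec)
open import Data.Nat.Properties
  using (_≟_; <-cmp; ≤-refl; ≤-trans; ≤-reflexive; <-irrefl; <-asym; <-trans; ≤-<-trans; <-≤-trans;
         <⇒≤; <⇒≢; <⇒≱; ≤⇒≯; ≤∧≢⇒<; ≤-<-connex; m≤n⇒m<n∨m≡n; m≤n⇒m≤1+n; n≮0; n<1+n; n≤1+n;
         <ᵇ⇒<; <⇒<ᵇ; ≡ᵇ⇒≡; ≡⇒≡ᵇ; suc-injective;
         +-comm; +-assoc; +-suc; +-identityʳ; +-cancelˡ-≡; +-cancelʳ-≡; +-cancelʳ-<;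
         +-monoˡ-≤; +-monoʳ-≤; +-monoˡ-<; +-monoʳ-<; +-mono-<; +-mono-≤-<; m≤m+n; m≤n+m; m<m+n;
         ∸-monoʳ-<; ∸-cancelʳ-<; m∸n≤m; m∸[m∸n]≡n; m∸n+n≡m; m+[n∸m]≡n; m+n∸n≡m; n∸n≡0;
         module ≤-Reasoning)
open import Data.Nat.Tactic.RingSolver using (solve-∀)
open import Data.Product using (Σ; _×_; _,_; proj₁; proj₂; swap)
open import Data.Sum using (_⊎_; inj₁; inj₂)
open import Data.Unit using (tt)
open import Data.Vec using (Vec; []; _∷_; _∷ʳ_; lookup; tabulate)
import Data.Vec as Vec
open import Data.Vec.Properties using (∷-injective; lookup∘tabulate)
open import Function using (id; _∘_; flip; Equivalence; mk⇔)
open import Relation.Binary.Definitions using (tri<; tri≈; tri>)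
open import Relation.Binary.PropositionalEquality
open import Relation.Nullary using (¬_; yes; no)
open import Relation.Nullary.Decidable using (T?)

-- Reading the Boolean definitions

allFin-T⁻ : ∀ {n} (p : Fin n → Bool) → T (all p (allFin n)) → ∀ i → T (p i)
allFin-T⁻ p t = tabulate⁻ (all⁺ p _ t)

allFin-T⁺ : ∀ {n} (p : Fin n → Bool) → (∀ i → T (p i)) → T (all p (allFin n))
allFin-T⁺ p h = all⁻ p (tabulate⁺ h)

allPairs⁻ : ∀ {n} (f : Fin n → Fin n → Bool) → T (allPairs f) → ∀ i j → T (f i j)
allPairs⁻ f t i = allFin-T⁻ (f i) (allFin-T⁻ _ t i)

allPairs⁺ : ∀ {n} (f : Fin n → Fin n → Bool) → (∀ i j → T (f i j)) → T (allPairs f)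
allPairs⁺ f h = allFin-T⁺ _ (λ i → allFin-T⁺ (f i) (h i))

T-∧⁻ : ∀ {a b} → T (a ∧ b) → T a × T b
T-∧⁻ = Equivalence.to T-∧

T-∧⁺ : ∀ {a b} → T a → T b → T (a ∧ b)
T-∧⁺ ta tb = Equivalence.from T-∧ (ta , tb)

allVecs-suc : ∀ n k → allVecs (suc n) k ≡ cartesianProductWith (flip _∷_) (allVecs n k) (allFin k)
allVecs-suc n k = go (allVecs n k)
  where
  go : ∀ vs → List.concatMap (λ v → map (_∷ v) (allFin k)) vs
            ≡ cartesianProductWith (flip _∷_) vs (allFin k)
  go []       = refl
  go (v ∷ vs) = cong (map (_∷ v) (allFin k) ++_) (go vs)

∈-allVecs : ∀ {n k} (v : Vec (Fin k) n) → v ∈ allVecs n k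
∈-allVecs []                    = here refl
∈-allVecs {suc n} {k} (x ∷ v) rewrite allVecs-suc n k =
  ∈-cartesianProductWith⁺ (flip _∷_) (∈-allVecs v) (∈-allFin x)

allVecs-unique : ∀ n k → Unique (allVecs n k)
allVecs-unique zero    k = All.[] ∷ []
allVecs-unique (suc n) k rewrite allVecs-suc n k =
  cartesianProductWith⁺ (flip _∷_) (swap ∘ ∷-injective) (allVecs-unique n k) (allFin⁺ k)

module _ {A : Set} (q : A → Bool) where

  private
    q? = T? ∘ q

  length-filter≡0⇒ : ∀ xs {x} → length (filterᵇ q xs) ≡ 0 → x ∈ xs → ¬ T (q x)
  length-filter≡0⇒ xs e x∈xs qx = <⇒≢ (filter-some q? (lose x∈xs qx)) (sym e)

  ⇒length-filter≡0 : ∀ xs → (∀ {x} → x ∈ xs → ¬ T (q x)) → length (filterᵇ q xs) ≡ 0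
  ⇒length-filter≡0 xs h = cong length (filter-none q? (All.tabulate h))

  length-filter≡1⇒witness : ∀ xs → length (filterᵇ q xs) ≡ 1 → Σ A λ x → x ∈ xs × T (q x)
  length-filter≡1⇒witness xs e with filterᵇ q xs in eq
  ... | y ∷ [] = y , ∈-filter⁻ q? {xs = xs} (subst (y ∈_) (sym eq) (here refl))

  length-filter≡1⇒unique : ∀ xs → length (filterᵇ q xs) ≡ 1 →
                   ∀ {x y} → x ∈ xs → T (q x) → y ∈ xs → T (q y) → x ≡ y
  length-filter≡1⇒unique xs e x∈ qx y∈ qy
    with filterᵇ q xs | ∈-filter⁺ q? x∈ qx | ∈-filter⁺ q? y∈ qy
  ... | _ ∷ [] | here refl | here refl = refl

  ⇒length-filter≡1 : ∀ xs → Unique xs → ∀ {x} → x ∈ xs → T (q x) →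
             (∀ {y} → y ∈ xs → T (q y) → y ≡ x) → length (filterᵇ q xs) ≡ 1
  ⇒length-filter≡1 xs u {x} x∈ qx only with filterᵇ q xs in eq | filter⁺ q? u | ∈-filter⁺ q? x∈ qx
  ... | y ∷ []     | _              | _ = refl
  ... | y ∷ z ∷ ys | (y≢z All.∷ _) ∷ _ | _ = ⊥-elim (y≢z (trans (is-x y (here refl)) (sym (is-x z (there (here refl))))))
    where
    is-x : ∀ w → w ∈ y ∷ z ∷ ys → w ≡ x
    is-x w w∈ = let w∈′ = subst (w ∈_) (sym eq) w∈ in
      only (proj₁ (∈-filter⁻ q? {xs = xs} w∈′)) (proj₂ (∈-filter⁻ q? {xs = xs} w∈′))

-- `at v i` reads the entry at position i as a number; it is 0 for i out of range.
at : ∀ {k n} → Vec (Fin k) n → ℕ → ℕ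
at []      i       = 0
at (x ∷ v) zero    = toℕ x
at (x ∷ v) (suc i) = at v i

at-lookup : ∀ {k n} (v : Vec (Fin k) n) i → at v (toℕ i) ≡ toℕ (lookup v i)
at-lookup (x ∷ v) fz     = refl
at-lookup (x ∷ v) (fs i) = at-lookup v i

at< : ∀ {k n} (v : Vec (Fin k) n) i → i < n → at v i < k
at< (x ∷ v) zero    _         = toℕ<n x
at< (x ∷ v) (suc i) (s≤s i<n) = at< v i i<n

at-ext : ∀ {k n} (v w : Vec (Fin k) n) → (∀ i → i < n → at v i ≡ at w i) → v ≡ w
at-ext []      []      _ = refl
at-ext (x ∷ v) (y ∷ w) h =
  cong₂ _∷_ (toℕ-injective (h 0 (s≤s z≤n))) (at-ext v w (λ i i<n → h (suc i) (s≤s i<n)))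

module _ {n : ℕ} (π : Perm n) {i j : Fin n} where

  lookup<⇒at< : toℕ (lookup π i) < toℕ (lookup π j) → at π (toℕ i) < at π (toℕ j)
  lookup<⇒at< = subst₂ _<_ (sym (at-lookup π i)) (sym (at-lookup π j))

  at<⇒lookup< : at π (toℕ i) < at π (toℕ j) → toℕ (lookup π i) < toℕ (lookup π j)
  at<⇒lookup< = subst₂ _<_ (at-lookup π i) (at-lookup π j)

Occ123 : ℕ → (ℕ → ℕ) → ℕ → ℕ → ℕ → Set
Occ123 n f a b c = a < b × b < c × c < n × f a < f b × f b < f c

Occ3412 : ℕ → (ℕ → ℕ) → ℕ → ℕ → ℕ → ℕ → Set
Occ3412 n f a b c d = a < b × b < c × c < d × d < n × f c < f d × f d < f a × f a < f b

record IsI3412-123 (n : ℕ) (f : ℕ → ℕ) : Set where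
  field
    range      : ∀ i → i < n → f i < n
    involutive : ∀ i → i < n → f (f i) ≡ i
    avoids3412 : ∀ {a b c d} → ¬ Occ3412 n f a b c d
    oa ob oc   : ℕ
    occ        : Occ123 n f oa ob oc
    occ-unique : ∀ {a b c} → Occ123 n f a b c → a ≡ oa × b ≡ ob × c ≡ oc

isOccurrence : ∀ {m n} → Perm m → Perm n → Vec (Fin n) m → Bool
isOccurrence σ π idx = increasing idx ∧ hasType σ π idx

isI3412-123 : ∀ {n} → Perm n → Bool
isI3412-123 π = isPerm π ∧ isInvolution π ∧ (occurrences p3412 π ≡ᵇ 0) ∧ (occurrences p123 π ≡ᵇ 1)

orderedAt : ∀ {m n} → Vec (Fin n) m → Fin m → Fin m → Bool
orderedAt idx a b = not (toℕ a <ᵇ toℕ b) ∨ (toℕ (lookup idx a) <ᵇ toℕ (lookup idx b))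

sameTypeAt : ∀ {m n} → Perm m → Perm n → Vec (Fin n) m → Fin m → Fin m → Bool
sameTypeAt σ π idx a b =
  not ((toℕ (lookup π (lookup idx a)) <ᵇ toℕ (lookup π (lookup idx b))) xor (toℕ (lookup σ a) <ᵇ toℕ (lookup σ b)))

module _ {m n} (σ : Perm m) (π : Perm n) (idx : Vec (Fin n) m) where

  isOccurrence⁻ : T (isOccurrence σ π idx) →
                  (∀ a b → T (orderedAt idx a b)) × (∀ a b → T (sameTypeAt σ π idx a b))
  isOccurrence⁻ t with T-∧⁻ {increasing idx} {hasType σ π idx} t
  ... | inc , typ = allPairs⁻ (orderedAt idx) inc , allPairs⁻ (sameTypeAt σ π idx) typ

  isOccurrence⁺ : (∀ a b → T (orderedAt idx a b)) → (∀ a b → T (sameTypeAt σ π idx a b)) →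
                  T (isOccurrence σ π idx)
  isOccurrence⁺ inc typ = T-∧⁺ {increasing idx} (allPairs⁺ (orderedAt idx) inc) (allPairs⁺ (sameTypeAt σ π idx) typ)

<ᵇ-irrefl : ∀ x → (x <ᵇ x) ≡ false
<ᵇ-irrefl zero    = refl
<ᵇ-irrefl (suc x) = <ᵇ-irrefl x

sameTypeAt-diag : ∀ {m n} (σ : Perm m) (π : Perm n) idx a → T (sameTypeAt σ π idx a a)
sameTypeAt-diag σ π idx a
  rewrite <ᵇ-irrefl (toℕ (lookup π (lookup idx a))) | <ᵇ-irrefl (toℕ (lookup σ a)) = tt

sameOrder⁻ : ∀ {x y} → T (not ((x <ᵇ y) xor true)) → x < y
sameOrder⁻ {x} {y} t with x <ᵇ y in eq
... | true = <ᵇ⇒< x y (subst T (sym eq) tt)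

sameOrder⁺ : ∀ {x y} → x < y → T (not ((x <ᵇ y) xor true))
sameOrder⁺ {x} {y} x<y with x <ᵇ y | <⇒<ᵇ x<y
... | true | _ = tt

oppositeOrder⁺ : ∀ {x y} → y ≤ x → T (not ((x <ᵇ y) xor false))
oppositeOrder⁺ {x} {y} y≤x with x <ᵇ y in eq
... | false = tt
... | true  = ≤⇒≯ y≤x (<ᵇ⇒< x y (subst T (sym eq) tt))

module _ {n : ℕ} (π : Perm n) where

  occ123⁻ : ∀ a b c → T (isOccurrence p123 π (a ∷ b ∷ c ∷ [])) →
            Occ123 n (at π) (toℕ a) (toℕ b) (toℕ c)
  occ123⁻ a b c t =
    <ᵇ⇒< _ _ (inc fz (fs fz)) , <ᵇ⇒< _ _ (inc (fs fz) (fs (fs fz))) , toℕ<n c ,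
    lookup<⇒at< π (sameOrder⁻ (typ fz (fs fz))) , lookup<⇒at< π (sameOrder⁻ (typ (fs fz) (fs (fs fz))))
    where
    inc = proj₁ (isOccurrence⁻ p123 π (a ∷ b ∷ c ∷ []) t)
    typ = proj₂ (isOccurrence⁻ p123 π (a ∷ b ∷ c ∷ []) t)

  occ3412⁻ : ∀ a b c d → T (isOccurrence p3412 π (a ∷ b ∷ c ∷ d ∷ [])) →
             Occ3412 n (at π) (toℕ a) (toℕ b) (toℕ c) (toℕ d)
  occ3412⁻ a b c d t =
    <ᵇ⇒< _ _ (inc fz (fs fz)) , <ᵇ⇒< _ _ (inc (fs fz) (fs (fs fz))) ,
    <ᵇ⇒< _ _ (inc (fs (fs fz)) (fs (fs (fs fz)))) , toℕ<n d ,
    lookup<⇒at< π (sameOrder⁻ (typ (fs (fs fz)) (fs (fs (fs fz))))) ,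
    lookup<⇒at< π (sameOrder⁻ (typ (fs (fs (fs fz))) fz)) ,
    lookup<⇒at< π (sameOrder⁻ (typ fz (fs fz)))
    where
    inc = proj₁ (isOccurrence⁻ p3412 π (a ∷ b ∷ c ∷ d ∷ []) t)
    typ = proj₂ (isOccurrence⁻ p3412 π (a ∷ b ∷ c ∷ d ∷ []) t)

  occ123⁺ : ∀ a b c → Occ123 n (at π) (toℕ a) (toℕ b) (toℕ c) →
            T (isOccurrence p123 π (a ∷ b ∷ c ∷ []))
  occ123⁺ a b c (a<b , b<c , _ , ab , bc) = isOccurrence⁺ p123 π idx inc typ
    where
    idx = a ∷ b ∷ c ∷ []
    A<B = at<⇒lookup< π ab
    B<C = at<⇒lookup< π bc
    A<C = <-trans A<B B<C
    inc : ∀ i j → T (orderedAt idx i j)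
    inc = λ where
      fz fz → tt ; fz (fs fz) → <⇒<ᵇ a<b ; fz (fs (fs fz)) → <⇒<ᵇ (<-trans a<b b<c)
      (fs fz) fz → tt ; (fs fz) (fs fz) → tt ; (fs fz) (fs (fs fz)) → <⇒<ᵇ b<c
      (fs (fs fz)) fz → tt ; (fs (fs fz)) (fs fz) → tt ; (fs (fs fz)) (fs (fs fz)) → tt
    typ : ∀ i j → T (sameTypeAt p123 π idx i j)
    typ = λ where
      fz fz → sameTypeAt-diag p123 π idx fz
      fz (fs fz) → sameOrder⁺ A<B
      fz (fs (fs fz)) → sameOrder⁺ A<C
      (fs fz) fz → oppositeOrder⁺ (<⇒≤ A<B)
      (fs fz) (fs fz) → sameTypeAt-diag p123 π idx (fs fz)
      (fs fz) (fs (fs fz)) → sameOrder⁺ B<C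
      (fs (fs fz)) fz → oppositeOrder⁺ (<⇒≤ A<C)
      (fs (fs fz)) (fs fz) → oppositeOrder⁺ (<⇒≤ B<C)
      (fs (fs fz)) (fs (fs fz)) → sameTypeAt-diag p123 π idx (fs (fs fz))

  occ3412⁺ : ∀ a b c d → Occ3412 n (at π) (toℕ a) (toℕ b) (toℕ c) (toℕ d) →
             T (isOccurrence p3412 π (a ∷ b ∷ c ∷ d ∷ []))
  occ3412⁺ a b c d (a<b , b<c , c<d , _ , cd , da , ab) = isOccurrence⁺ p3412 π idx inc typ
    where
    idx = a ∷ b ∷ c ∷ d ∷ []
    a<c = <-trans a<b b<c
    b<d = <-trans b<c c<d
    C<D = at<⇒lookup< π cd
    D<A = at<⇒lookup< π da
    A<B = at<⇒lookup< π ab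
    C<A = <-trans C<D D<A
    D<B = <-trans D<A A<B
    C<B = <-trans C<A A<B
    inc : ∀ i j → T (orderedAt idx i j)
    inc = λ where
      fz fz → tt ; fz (fs fz) → <⇒<ᵇ a<b ; fz (fs (fs fz)) → <⇒<ᵇ a<c
      fz (fs (fs (fs fz))) → <⇒<ᵇ (<-trans a<c c<d)
      (fs fz) fz → tt ; (fs fz) (fs fz) → tt ; (fs fz) (fs (fs fz)) → <⇒<ᵇ b<c
      (fs fz) (fs (fs (fs fz))) → <⇒<ᵇ b<d
      (fs (fs fz)) fz → tt ; (fs (fs fz)) (fs fz) → tt ; (fs (fs fz)) (fs (fs fz)) → tt
      (fs (fs fz)) (fs (fs (fs fz))) → <⇒<ᵇ c<d
      (fs (fs (fs fz))) fz → tt ; (fs (fs (fs fz))) (fs fz) → tt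
      (fs (fs (fs fz))) (fs (fs fz)) → tt ; (fs (fs (fs fz))) (fs (fs (fs fz))) → tt
    typ : ∀ i j → T (sameTypeAt p3412 π idx i j)
    typ = λ where
      fz fz → sameTypeAt-diag p3412 π idx fz
      fz (fs fz) → sameOrder⁺ A<B
      fz (fs (fs fz)) → oppositeOrder⁺ (<⇒≤ C<A)
      fz (fs (fs (fs fz))) → oppositeOrder⁺ (<⇒≤ D<A)
      (fs fz) fz → oppositeOrder⁺ (<⇒≤ A<B)
      (fs fz) (fs fz) → sameTypeAt-diag p3412 π idx (fs fz)
      (fs fz) (fs (fs fz)) → oppositeOrder⁺ (<⇒≤ C<B)
      (fs fz) (fs (fs (fs fz))) → oppositeOrder⁺ (<⇒≤ D<B)
      (fs (fs fz)) fz → sameOrder⁺ C<A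
      (fs (fs fz)) (fs fz) → sameOrder⁺ C<B
      (fs (fs fz)) (fs (fs fz)) → sameTypeAt-diag p3412 π idx (fs (fs fz))
      (fs (fs fz)) (fs (fs (fs fz))) → sameOrder⁺ C<D
      (fs (fs (fs fz))) fz → sameOrder⁺ D<A
      (fs (fs (fs fz))) (fs fz) → sameOrder⁺ D<B
      (fs (fs (fs fz))) (fs (fs fz)) → oppositeOrder⁺ (<⇒≤ C<D)
      (fs (fs (fs fz))) (fs (fs (fs fz))) → sameTypeAt-diag p3412 π idx (fs (fs (fs fz)))

implies⇒T-∨-not : ∀ {a b} → (T b → T a) → T (a ∨ not b)
implies⇒T-∨-not {true}          _ = tt
implies⇒T-∨-not {false} {false} _ = tt
implies⇒T-∨-not {false} {true}  h = h tt

module _ {n : ℕ} (π : Perm n) where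

  private
    f = at π

  fins123 : ∀ {a b c} → Occ123 n f a b c → Vec (Fin n) 3
  fins123 (a<b , b<c , c<n , _) =
    fromℕ< (<-trans a<b (<-trans b<c c<n)) ∷ fromℕ< (<-trans b<c c<n) ∷ fromℕ< c<n ∷ []

  fins123-isOccurrence : ∀ {a b c} (o : Occ123 n f a b c) → T (isOccurrence p123 π (fins123 o))
  fins123-isOccurrence o@(a<b , b<c , c<n , _) = occ123⁺ π _ _ _
    (subst₂ (λ x yz → Occ123 n f x (proj₁ yz) (proj₂ yz))
            (sym (toℕ-fromℕ< _)) (cong₂ _,_ (sym (toℕ-fromℕ< _)) (sym (toℕ-fromℕ< c<n))) o)

  fins123-unique : ∀ {a b c} (o : Occ123 n f a b c) {x y z} →
                   toℕ x ≡ a → toℕ y ≡ b → toℕ z ≡ c → x ∷ y ∷ z ∷ [] ≡ fins123 o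
  fins123-unique (a<b , b<c , c<n , _) ex ey ez =
    cong₂ _∷_ (fin≡ a<n ex) (cong₂ _∷_ (fin≡ b<n ey) (cong₂ _∷_ (fin≡ c<n ez) refl))
    where
    b<n = <-trans b<c c<n
    a<n = <-trans a<b b<n
    fin≡ : ∀ {i x} (i<n : i < n) → toℕ x ≡ i → x ≡ fromℕ< i<n
    fin≡ _ e = toℕ-injective (trans e (sym (toℕ-fromℕ< _)))

  occ3412⇒occurrence : ∀ {a b c d} → Occ3412 n f a b c d → Σ (Vec (Fin n) 4) λ idx → T (isOccurrence p3412 π idx)
  occ3412⇒occurrence o@(a<b , b<c , c<d , d<n , _) =
    fromℕ< a<n ∷ fromℕ< b<n ∷ fromℕ< c<n ∷ fromℕ< d<n ∷ [] , occ3412⁺ π (fromℕ< a<n) (fromℕ< b<n) (fromℕ< c<n) (fromℕ< d<n)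
          (subst₂ (λ ab cd → Occ3412 n f (proj₁ ab) (proj₂ ab) (proj₁ cd) (proj₂ cd))
                  (sym (cong₂ _,_ (toℕ-fromℕ< a<n) (toℕ-fromℕ< b<n)))
                  (sym (cong₂ _,_ (toℕ-fromℕ< c<n) (toℕ-fromℕ< d<n))) o)
    where
    c<n = <-trans c<d d<n
    b<n = <-trans b<c c<n
    a<n = <-trans a<b b<n

  isInvolution⁻ : T (isInvolution π) → ∀ i → i < n → f (f i) ≡ i
  isInvolution⁻ t i i<n = begin
    f (f i)                      ≡⟨ cong (f ∘ f) (sym (toℕ-fromℕ< i<n)) ⟩
    f (f (toℕ j))                ≡⟨ cong f (at-lookup π j) ⟩
    f (toℕ (lookup π j))         ≡⟨ at-lookup π (lookup π j) ⟩
    toℕ (lookup π (lookup π j))  ≡⟨ ≡ᵇ⇒≡ _ _ (allFin-T⁻ (λ i → toℕ (lookup π (lookup π i)) ≡ᵇ toℕ i) t j) ⟩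
    toℕ j                        ≡⟨ toℕ-fromℕ< i<n ⟩
    i                            ∎
    where
    open ≡-Reasoning
    j = fromℕ< i<n

  isInvolution⁺ : (∀ i → i < n → f (f i) ≡ i) → T (isInvolution π)
  isInvolution⁺ inv = allFin-T⁺ (λ i → toℕ (lookup π (lookup π i)) ≡ᵇ toℕ i) λ i →
    ≡⇒≡ᵇ _ _ (trans (sym (trans (cong f (at-lookup π i)) (at-lookup π (lookup π i)))) (inv (toℕ i) (toℕ<n i)))

  isPerm⁺ : (∀ i → i < n → f (f i) ≡ i) → T (isPerm π)
  isPerm⁺ inv = allPairs⁺ _ λ i j → implies⇒T-∨-not λ same →
    ≡⇒≡ᵇ _ _ (begin
      toℕ i              ≡⟨ inv (toℕ i) (toℕ<n i) ⟨
      f (f (toℕ i))      ≡⟨ cong f (trans (at-lookup π i) (trans (≡ᵇ⇒≡ _ _ same) (sym (at-lookup π j)))) ⟩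
      f (f (toℕ j))      ≡⟨ inv (toℕ j) (toℕ<n j) ⟩
      toℕ j              ∎)
    where open ≡-Reasoning

  T-isI⇒IsI : T (isI3412-123 π) → IsI3412-123 n f
  T-isI⇒IsI t with T-∧⁻ {isPerm π} t
  ... | _ , t′ with T-∧⁻ {isInvolution π} t′
  ... | inv , t″ with T-∧⁻ {occurrences p3412 π ≡ᵇ 0} t″
  ... | no3412 , one123 with length-filter≡1⇒witness (isOccurrence p123 π) (allVecs 3 n) (≡ᵇ⇒≡ _ 1 one123)
  ... | a ∷ b ∷ c ∷ [] , w∈ , w-occ = record
    { range      = at< π
    ; involutive = isInvolution⁻ inv
    ; avoids3412 = λ o → let idx , idx-occ = occ3412⇒occurrence o in
        length-filter≡0⇒ (isOccurrence p3412 π) (allVecs 4 n) (≡ᵇ⇒≡ _ 0 no3412) (∈-allVecs idx) idx-occ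
    ; oa = toℕ a ; ob = toℕ b ; oc = toℕ c
    ; occ        = occ123⁻ π a b c w-occ
    ; occ-unique = λ o →
        let same = length-filter≡1⇒unique (isOccurrence p123 π) (allVecs 3 n) (≡ᵇ⇒≡ _ 1 one123)
                     (∈-allVecs (fins123 o)) (fins123-isOccurrence o) w∈ w-occ
            pos : ∀ k → toℕ (lookup (fins123 o) k) ≡ toℕ (lookup (a ∷ b ∷ c ∷ []) k)
            pos k = cong (λ v → toℕ (lookup v k)) same
        in trans (sym (toℕ-fromℕ< _)) (pos fz) , trans (sym (toℕ-fromℕ< _)) (pos (fs fz)) ,
           trans (sym (toℕ-fromℕ< _)) (pos (fs (fs fz)))
    }

  IsI⇒T-isI : IsI3412-123 n f → T (isI3412-123 π)
  IsI⇒T-isI I = T-∧⁺ {isPerm π} (isPerm⁺ involutive) (T-∧⁺ {isInvolution π} (isInvolution⁺ involutive)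
               (T-∧⁺ {occurrences p3412 π ≡ᵇ 0} (≡⇒≡ᵇ _ 0 no3412) (≡⇒≡ᵇ _ 1 one123)))
    where
    open IsI3412-123 I
    no3412 : length (filterᵇ (isOccurrence p3412 π) (allVecs 4 n)) ≡ 0
    no3412 = ⇒length-filter≡0 (isOccurrence p3412 π) (allVecs 4 n) not-3412
      where
      not-3412 : ∀ {idx} → idx ∈ allVecs 4 n → ¬ T (isOccurrence p3412 π idx)
      not-3412 {a ∷ b ∷ c ∷ d ∷ []} _ o = avoids3412 (occ3412⁻ π a b c d o)
    one123 : length (filterᵇ (isOccurrence p123 π) (allVecs 3 n)) ≡ 1
    one123 = ⇒length-filter≡1 (isOccurrence p123 π) (allVecs 3 n) (allVecs-unique 3 n)
      (∈-allVecs (fins123 occ)) (fins123-isOccurrence occ) only-occ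
      where
      only-occ : ∀ {idx} → idx ∈ allVecs 3 n → T (isOccurrence p123 π idx) → idx ≡ fins123 occ
      only-occ {a ∷ b ∷ c ∷ []} _ o = let ea , eb , ec = occ-unique (occ123⁻ π a b c o) in fins123-unique occ ea eb ec

-- Structure of the involutions

module Properties {n : ℕ} {f : ℕ → ℕ} (I : IsI3412-123 n f) where

  open IsI3412-123 I public

  injective : ∀ {i j} → i < n → j < n → f i ≡ f j → i ≡ j
  injective {i} {j} i<n j<n e = trans (sym (involutive i i<n)) (trans (cong f e) (involutive j j<n))

  occ-unique₂ : ∀ {a b c a′ b′ c′} → Occ123 n f a b c → Occ123 n f a′ b′ c′ → a ≡ a′ × b ≡ b′ × c ≡ c′
  occ-unique₂ o o′ with occ-unique o | occ-unique o′
  ... | ea , eb , ec | ea′ , eb′ , ec′ = trans ea (sym ea′) , trans eb (sym eb′) , trans ec (sym ec′)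

  oa<ob : oa < ob
  oa<ob = proj₁ occ

  ob<oc : ob < oc
  ob<oc = proj₁ (proj₂ occ)

  oc<n : oc < n
  oc<n = proj₁ (proj₂ (proj₂ occ))

  foa<fob : f oa < f ob
  foa<fob = proj₁ (proj₂ (proj₂ (proj₂ occ)))

  fob<foc : f ob < f oc
  fob<foc = proj₂ (proj₂ (proj₂ (proj₂ occ)))

  ob<n : ob < n
  ob<n = <-trans ob<oc oc<n

  oa<n : oa < n
  oa<n = <-trans oa<ob ob<n

  3≤n : 3 ≤ n
  3≤n = ≤-trans (s≤s (≤-trans (s≤s (≤-<-trans z≤n oa<ob)) ob<oc)) oc<n

module Corners {m : ℕ} {f : ℕ → ℕ} (I : IsI3412-123 (suc m) f) where

  open Properties I

  private
    0<n : 0 < suc m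
    0<n = s≤s z≤n

    m<n : m < suc m
    m<n = ≤-refl

    at-most-m : ∀ x → x < suc m → f x ≤ m
    at-most-m x x<n = s≤s⁻¹ (range x x<n)

  -- With j = f 0 and k = f m, the letters 0 and m of the involution sit at positions j and k.
  module _ (j≢0 : f 0 ≢ 0) (j≢m : f 0 ≢ m) (k≢m : f m ≢ m) where

    private
      j = f 0
      k = f m

      fj : f j ≡ 0
      fj = involutive 0 0<n

      fk : f k ≡ m
      fk = involutive m m<n

      0<j : 0 < j
      0<j = ≤∧≢⇒< z≤n (j≢0 ∘ sym)

      j<m : j < m
      j<m = ≤∧≢⇒< (at-most-m 0 0<n) j≢m

      k<m : k < m
      k<m = ≤∧≢⇒< (at-most-m m m<n) k≢m

      0<k : 0 < k
      0<k = ≤∧≢⇒< z≤n λ k≡0 → j≢m (trans (cong f k≡0) fk)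

      j<k : j < k
      j<k with <-cmp j k
      ... | tri< j<k _ _ = j<k
      ... | tri≈ _ j≡k _ = ⊥-elim (<-irrefl (trans (sym fj) (trans (cong f j≡k) fk)) (<-trans 0<j j<m))
      ... | tri> _ _ k<j = ⊥-elim (avoids3412 (0<k , k<j , j<m , m<n ,
              subst (_< f m) (sym fj) 0<k , k<j , subst (j <_) (sym fk) j<m))

      below-m : ∀ {x} → x < suc m → x ≢ k → f x < m
      below-m {x} x<n x≢k = ≤∧≢⇒< (at-most-m x x<n) λ e → x≢k (injective x<n (<-trans k<m m<n) (trans e (sym fk)))

      above-0 : ∀ {x} → x < suc m → x ≢ j → 0 < f x
      above-0 {x} x<n x≢j = ≤∧≢⇒< z≤n λ e → x≢j (injective x<n (<-trans j<m m<n) (trans (sym e) (sym fj)))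

      occ-0xk : ∀ {x} → 0 < x → x < k → j < f x → Occ123 (suc m) f 0 x k
      occ-0xk {x} 0<x x<k jx = 0<x , x<k , <-trans k<m m<n , jx ,
        subst (f x <_) (sym fk) (below-m (<-trans x<k (<-trans k<m m<n)) λ x≡k → <-irrefl x≡k x<k)

      occ-jxm : ∀ {x} → j < x → x < m → f x < k → Occ123 (suc m) f j x m
      occ-jxm {x} j<x x<m xk = j<x , x<m , m<n ,
        subst (_< f x) (sym fj) (above-0 (<-trans x<m m<n) λ x≡j → <-irrefl (sym x≡j) j<x) , xk

      firsts-differ : ∀ {b c b′ c′} → Occ123 (suc m) f 0 b c → Occ123 (suc m) f j b′ c′ → ⊥
      firsts-differ o o′ = <-irrefl (proj₁ (occ-unique₂ o o′)) 0<j

      lasts-differ : ∀ {a b a′ b′} → Occ123 (suc m) f a b k → Occ123 (suc m) f a′ b′ m → ⊥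
      lasts-differ o o′ = <-irrefl (proj₂ (proj₂ (occ-unique₂ o o′))) k<m

      -- x and f x would start the two different occurrences 0 x k and j (f x) m.
      no-crossing : ∀ {x} → 0 < x → x < k → j < f x → ⊥
      no-crossing {x} 0<x x<k jx = firsts-differ (occ-0xk 0<x x<k jx)
        (occ-jxm jx (below-m x<n λ x≡k → <-irrefl x≡k x<k) (subst (_< k) (sym (involutive x x<n)) x<k))
        where x<n = <-trans x<k (<-trans k<m m<n)

    -- Moving an end of the occurrence (oa, ob, oc) to 0, j, k or m always yields a second occurrence.
    no-corner : ⊥
    no-corner with <-cmp ob k
    ... | tri≈ _ b≡k _ = <-irrefl refl (<-≤-trans (subst (_< f oc) (trans (cong f b≡k) fk) fob<foc) (at-most-m oc oc<n))
    ... | tri< b<k _ _ with <-cmp (f ob) k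
    ...   | tri< fb<k _ _ = lasts-differ (oa<ob , b<k , <-trans k<m m<n , foa<fob , subst (f ob <_) (sym fk) (below-m ob<n λ e → <-irrefl e b<k))
                                         (oa<ob , <-trans b<k k<m , m<n , foa<fob , fb<k)
    ...   | tri≈ _ fb≡k _ = <-irrefl (trans (sym (involutive ob ob<n)) (trans (cong f fb≡k) fk)) (<-trans b<k k<m)
    ...   | tri> _ _ k<fb = no-crossing (≤-<-trans z≤n oa<ob) b<k (<-trans j<k k<fb)
    no-corner | tri> _ _ k<b with <-cmp (f ob) j
    ...   | tri> _ _ j<fb = firsts-differ (≤-<-trans z≤n oa<ob , ob<oc , oc<n , j<fb , fob<foc)
                                          (<-trans j<k k<b , ob<oc , oc<n , subst (_< f ob) (sym fj) (above-0 ob<n b≢j) , fob<foc)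
      where b≢j = λ e → <-irrefl (sym e) (<-trans j<k k<b)
    ...   | tri≈ _ fb≡j _ = <-irrefl (trans (sym (trans (cong f fb≡j) fj)) (involutive ob ob<n)) (≤-<-trans z≤n oa<ob)
    ...   | tri< fb<j _ _ = no-crossing (above-0 ob<n λ e → <-irrefl (sym e) (<-trans j<k k<b)) (<-trans fb<j j<k)
                              (subst (j <_) (sym (involutive ob ob<n)) (<-trans j<k k<b))

  corners : f 0 ≡ m ⊎ f 0 ≡ 0 ⊎ f m ≡ m
  corners with f 0 ≟ m | f 0 ≟ 0 | f m ≟ m
  ... | yes e | _     | _     = inj₁ e
  ... | no _  | yes e | _     = inj₂ (inj₁ e)
  ... | no _  | no _  | yes e = inj₂ (inj₂ e)
  ... | no j≢m | no j≢0 | no k≢m = ⊥-elim (no-corner j≢0 j≢m k≢m)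

IsI-cong : ∀ {n f g} → IsI3412-123 n f → (∀ i → i < n → f i ≡ g i) → IsI3412-123 n g
IsI-cong {n} {f} {g} I f≗g = record
  { range      = λ i i<n → subst (_< n) (f≗g i i<n) (range i i<n)
  ; involutive = λ i i<n → trans (sym (f≗g (g i) (subst (_< n) (f≗g i i<n) (range i i<n))))
                                 (trans (cong f (sym (f≗g i i<n))) (involutive i i<n))
  ; avoids3412 = λ (a<b , b<c , c<d , d<n , cd , da , ab) →
      let c<n = <-trans c<d d<n ; b<n = <-trans b<c c<n ; a<n = <-trans a<b b<n in
      avoids3412 (a<b , b<c , c<d , d<n , back c<n d<n cd , back d<n a<n da , back a<n b<n ab)
  ; oa = oa ; ob = ob ; oc = oc
  ; occ        = oa<ob , ob<oc , oc<n , forth oa<n ob<n foa<fob , forth ob<n oc<n fob<foc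
  ; occ-unique = λ (a<b , b<c , c<n , ab , bc) →
      let b<n = <-trans b<c c<n ; a<n = <-trans a<b b<n in
      occ-unique (a<b , b<c , c<n , back a<n b<n ab , back b<n c<n bc)
  }
  where
  open Properties I
  forth : ∀ {x y} → x < n → y < n → f x < f y → g x < g y
  forth x<n y<n = subst₂ _<_ (f≗g _ x<n) (f≗g _ y<n)
  back : ∀ {x y} → x < n → y < n → g x < g y → f x < f y
  back x<n y<n = subst₂ _<_ (sym (f≗g _ x<n)) (sym (f≗g _ y<n))

data Position (m : ℕ) : ℕ → Set where
  first : Position m 0
  inner : ∀ {i} → i < m → Position m (suc i)
  last  : Position m (suc m)

position : ∀ m {i} → i < suc (suc m) → Position m i
position m {zero}  _ = first
position m {suc i} (s≤s i<sm) with m≤n⇒m<n∨m≡n (s≤s⁻¹ i<sm)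
... | inj₁ i<m  = inner i<m
... | inj₂ refl = last

module Wrap {m : ℕ} {g : ℕ → ℕ} (I : IsI3412-123 m g) (h : ℕ → ℕ)
            (h-first : h 0 ≡ suc m) (h-last : h (suc m) ≡ 0)
            (h-inner : ∀ i → i < m → h (suc i) ≡ suc (g i)) where

  open Properties I

  private
    n = suc (suc m)

    h-range : ∀ i → i < n → h i < n
    h-range i i<n with position m i<n
    ... | first     = subst (_< n) (sym h-first) ≤-refl
    ... | last      = subst (_< n) (sym h-last) (s≤s z≤n)
    ... | inner i<m = subst (_< n) (sym (h-inner _ i<m)) (s≤s (m≤n⇒m≤1+n (range _ i<m)))

    h-involutive : ∀ i → i < n → h (h i) ≡ i
    h-involutive i i<n with position m i<n
    ... | first     = trans (cong h h-first) h-last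
    ... | last      = trans (cong h h-last) h-first
    ... | inner i<m = trans (cong h (h-inner _ i<m)) (trans (h-inner _ (range _ i<m)) (cong suc (involutive _ i<m)))

    ascent-not-first : ∀ {x y} → y < n → h x < h y → 0 < x
    ascent-not-first {zero} {y} y<n hx<hy = ⊥-elim (≤⇒≯ (s≤s⁻¹ (h-range y y<n)) (subst (_< h y) h-first hx<hy))
    ascent-not-first {suc x} _   _     = s≤s z≤n

    ascent-not-last : ∀ {x y} → y < n → h x < h y → y < suc m
    ascent-not-last {x} y<n hx<hy = ≤∧≢⇒< (s≤s⁻¹ y<n) λ y≡sm → n≮0 (subst (h x <_) (trans (cong h y≡sm) h-last) hx<hy)

    shift⁻ : ∀ {x y} → x < m → y < m → h (suc x) < h (suc y) → g x < g y
    shift⁻ x<m y<m = s≤s⁻¹ ∘ subst₂ _<_ (h-inner _ x<m) (h-inner _ y<m)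

    shift⁺ : ∀ {x y} → x < m → y < m → g x < g y → h (suc x) < h (suc y)
    shift⁺ x<m y<m = subst₂ _<_ (sym (h-inner _ x<m)) (sym (h-inner _ y<m)) ∘ s≤s

    h-avoids3412 : ∀ {a b c d} → ¬ Occ3412 n h a b c d
    h-avoids3412 (_ , b<c , c<d , d<n , hcd , _ , hab) with ascent-not-first (<-trans b<c (<-trans c<d d<n)) hab | ascent-not-last d<n hcd
    h-avoids3412 {suc a} {suc b} {suc c} {suc d} (s≤s a<b , s≤s b<c , s≤s c<d , _ , hcd , hda , hab) | _ | s≤s d<m =
      avoids3412 (a<b , b<c , c<d , d<m , shift⁻ c<m d<m hcd , shift⁻ d<m a<m hda , shift⁻ a<m b<m hab)
      where
      c<m = <-trans c<d d<m
      b<m = <-trans b<c c<m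
      a<m = <-trans a<b b<m

    h-occ-unique : ∀ {a b c} → Occ123 n h a b c → a ≡ suc oa × b ≡ suc ob × c ≡ suc oc
    h-occ-unique (_ , b<c , c<n , hab , hbc) with ascent-not-first (<-trans b<c c<n) hab | ascent-not-last c<n hbc
    h-occ-unique {suc a} {suc b} {suc c} (s≤s a<b , s≤s b<c , _ , hab , hbc) | _ | s≤s c<m =
      let ea , eb , ec = occ-unique (a<b , b<c , c<m , shift⁻ a<m b<m hab , shift⁻ b<m c<m hbc) in
      cong suc ea , cong suc eb , cong suc ec
      where
      b<m = <-trans b<c c<m
      a<m = <-trans a<b b<m

  isI : IsI3412-123 n h
  isI = record
    { range      = h-range
    ; involutive = h-involutive
    ; avoids3412 = h-avoids3412
    ; oa = suc oa ; ob = suc ob ; oc = suc oc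
    ; occ        = s≤s oa<ob , s≤s ob<oc , s≤s (m≤n⇒m≤1+n oc<n) ,
                   shift⁺ oa<n ob<n foa<fob , shift⁺ ob<n oc<n fob<foc
    ; occ-unique = h-occ-unique
    }

module Unwrap {m : ℕ} {f : ℕ → ℕ} (I : IsI3412-123 (suc (suc m)) f) (f-first : f 0 ≡ suc m) where

  open Properties I

  g : ℕ → ℕ
  g i = pred (f (suc i))

  f-last : f (suc m) ≡ 0
  f-last = trans (cong f (sym f-first)) (involutive 0 (s≤s z≤n))

  private
    n = suc (suc m)

    inner<n : ∀ {i} → i < m → suc i < n
    inner<n i<m = s≤s (m≤n⇒m≤1+n i<m)

    f-inner-pos : ∀ {i} → i < m → 0 < f (suc i)
    f-inner-pos {i} i<m = ≤∧≢⇒< z≤n λ e →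
      <-irrefl (injective (inner<n i<m) ≤-refl (trans (sym e) (sym f-last))) (s≤s i<m)

  f-inner : ∀ {i} → i < m → f (suc i) ≡ suc (g i)
  f-inner {i} i<m with f (suc i) | f-inner-pos i<m
  ... | suc _ | _ = refl

  g<m : ∀ i → i < m → g i < m
  g<m i i<m = s≤s⁻¹ (≤∧≢⇒< (s≤s⁻¹ (subst (_< n) (f-inner i<m) (range (suc i) (inner<n i<m)))) λ e →
    <-irrefl (sym (injective (inner<n i<m) (s≤s z≤n) (trans (f-inner i<m) (trans e (sym f-first))))) (s≤s z≤n))

  private
    shift⁻ : ∀ {x y} → x < m → y < m → f (suc x) < f (suc y) → g x < g y
    shift⁻ x<m y<m = s≤s⁻¹ ∘ subst₂ _<_ (f-inner x<m) (f-inner y<m)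

    shift⁺ : ∀ {x y} → x < m → y < m → g x < g y → f (suc x) < f (suc y)
    shift⁺ x<m y<m = subst₂ _<_ (sym (f-inner x<m)) (sym (f-inner y<m)) ∘ s≤s

    occ-inner : 0 < oa × oc < suc m
    occ-inner =
      ≤∧≢⇒< z≤n (λ e → ≤⇒≯ (s≤s⁻¹ (range ob ob<n)) (subst (_< f ob) (trans (cong f (sym e)) f-first) foa<fob)) ,
      ≤∧≢⇒< (s≤s⁻¹ oc<n) (λ e → n≮0 (subst (f ob <_) (trans (cong f e) f-last) fob<foc))

    g-occ : Occ123 m g (pred oa) (pred ob) (pred oc)
    g-occ with oa | ob | oc | occ | occ-inner
    ... | suc a | suc b | suc c | s≤s a<b , s≤s b<c , _ , fab , fbc | _ , s≤s c<m =
      a<b , b<c , c<m , shift⁻ (<-trans a<b b<m) b<m fab , shift⁻ b<m c<m fbc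
      where b<m = <-trans b<c c<m

  isI : IsI3412-123 m g
  isI = record
    { range      = g<m
    ; involutive = λ i i<m → trans (cong (pred ∘ f) (sym (f-inner i<m))) (cong pred (involutive (suc i) (inner<n i<m)))
    ; avoids3412 = λ (a<b , b<c , c<d , d<m , gcd , gda , gab) →
        let c<m = <-trans c<d d<m ; b<m = <-trans b<c c<m ; a<m = <-trans a<b b<m in
        avoids3412 (s≤s a<b , s≤s b<c , s≤s c<d , s≤s (m≤n⇒m≤1+n d<m) ,
                    shift⁺ c<m d<m gcd , shift⁺ d<m a<m gda , shift⁺ a<m b<m gab)
    ; oa = pred oa ; ob = pred ob ; oc = pred oc
    ; occ        = g-occ
    ; occ-unique = λ (a<b , b<c , c<m , gab , gbc) →
        let b<m = <-trans b<c c<m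
            ea , eb , ec = occ-unique (s≤s a<b , s≤s b<c , s≤s (m≤n⇒m≤1+n c<m) ,
                                       shift⁺ (<-trans a<b b<m) b<m gab , shift⁺ b<m c<m gbc)
        in cong pred ea , cong pred eb , cong pred ec
    }

module ReverseComplement {m : ℕ} {f : ℕ → ℕ} (I : IsI3412-123 (suc m) f) where

  open Properties I

  rc : ℕ → ℕ
  rc i = m ∸ f (m ∸ i)

  private
    n = suc m

    reflect< : ∀ {x y} → x < y → y ≤ m → m ∸ y < m ∸ x
    reflect< = ∸-monoʳ-<

    rc⁻ : ∀ x y → rc x < rc y → f (m ∸ y) < f (m ∸ x)
    rc⁻ x y = ∸-cancelʳ-< {f (m ∸ x)} {f (m ∸ y)}

    reflect-bound : ∀ x → m ∸ x < n
    reflect-bound x = s≤s (m∸n≤m m x)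

    rc-at-reflection : ∀ {x} → x < n → rc (m ∸ x) ≡ m ∸ f x
    rc-at-reflection x<n = cong (λ z → m ∸ f z) (m∸[m∸n]≡n (s≤s⁻¹ x<n))

    to-f : ∀ {a b c} → Occ123 n rc a b c → Occ123 n f (m ∸ c) (m ∸ b) (m ∸ a)
    to-f {a} {b} {c} (a<b , b<c , c<n , ab , bc) =
      reflect< b<c (s≤s⁻¹ c<n) , reflect< a<b (s≤s⁻¹ (<-trans b<c c<n)) , reflect-bound a ,
      rc⁻ b c bc , rc⁻ a b ab

    rc-occ-unique : ∀ {a b c} → Occ123 n rc a b c → a ≡ m ∸ oc × b ≡ m ∸ ob × c ≡ m ∸ oa
    rc-occ-unique o@(a<b , b<c , c<n , _) =
      let ea , eb , ec = occ-unique (to-f o)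
          b<n = <-trans b<c c<n
      in unreflect (<-trans a<b b<n) ec , unreflect b<n eb , unreflect c<n ea
      where
      unreflect : ∀ {x y} → x < n → m ∸ x ≡ y → x ≡ m ∸ y
      unreflect x<n e = trans (sym (m∸[m∸n]≡n (s≤s⁻¹ x<n))) (cong (m ∸_) e)

  isI : IsI3412-123 n rc
  isI = record
    { range      = λ i _ → reflect-bound (f (m ∸ i))
    ; involutive = λ i i<n →
        trans (cong (λ z → m ∸ f z) (m∸[m∸n]≡n (s≤s⁻¹ (range _ (reflect-bound i)))))
              (trans (cong (m ∸_) (involutive (m ∸ i) (reflect-bound i))) (m∸[m∸n]≡n (s≤s⁻¹ i<n)))
    ; avoids3412 = λ {a} {b} {c} {d} (a<b , b<c , c<d , d<n , cd , da , ab) →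
        let c<n = <-trans c<d d<n ; b<n = <-trans b<c c<n in
        avoids3412 (reflect< c<d (s≤s⁻¹ d<n) , reflect< b<c (s≤s⁻¹ c<n) , reflect< a<b (s≤s⁻¹ b<n) ,
                    reflect-bound a , rc⁻ a b ab , rc⁻ d a da , rc⁻ c d cd)
    ; oa = m ∸ oc ; ob = m ∸ ob ; oc = m ∸ oa
    ; occ        = reflect< ob<oc (s≤s⁻¹ oc<n) , reflect< oa<ob (s≤s⁻¹ ob<n) , reflect-bound oa ,
                   subst₂ _<_ (sym (rc-at-reflection oc<n)) (sym (rc-at-reflection ob<n))
                     (reflect< fob<foc (s≤s⁻¹ (range oc oc<n))) ,
                   subst₂ _<_ (sym (rc-at-reflection ob<n)) (sym (rc-at-reflection oa<n))
                     (reflect< foa<fob (s≤s⁻¹ (range ob ob<n)))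
    ; occ-unique = rc-occ-unique
    }

-- The shape of 1 ⊕ δ on {0, …, 2p}: δ reverses {1, …, 2p} except that it fixes p and p + 1.
record FixedZeroShape (p : ℕ) (f : ℕ → ℕ) : Set where
  field
    fix-0         : f 0 ≡ 0
    fix-p         : f p ≡ p
    fix-p+1       : f (suc p) ≡ suc p
    reverse-left  : ∀ i → 0 < i → i < p → f i + i ≡ suc (p + p)
    reverse-right : ∀ i → suc p < i → i < suc (p + p) → f i + i ≡ suc (p + p)

module FixedZero {m : ℕ} {f : ℕ → ℕ} (I : IsI3412-123 (suc m) f) (f-0 : f 0 ≡ 0) where

  open Properties I

  private
    n = suc m
    p = ob
    q = oc

    positive : ∀ {x} → x < n → 0 < x → 0 < f x
    positive {x} x<n 0<x = ≤∧≢⇒< z≤n λ e → <-irrefl (trans (sym (trans (cong f (sym e)) f-0)) (involutive x x<n)) 0<x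

    -- every ascent away from position 0 extends 0 to an occurrence of 123
    ascent : ∀ {i j} → 0 < i → i < j → j < n → f i < f j → i ≡ p × j ≡ q
    ascent {i} 0<i i<j j<n fi<fj =
      proj₂ (occ-unique (0<i , i<j , j<n , subst (_< f i) (sym f-0) (positive (<-trans i<j j<n) 0<i) , fi<fj))

    0<p : 0 < p
    0<p = ≤-<-trans z≤n oa<ob

    fix-p-q : f p ≡ p × f q ≡ q
    fix-p-q = ascent (positive ob<n 0<p) fob<foc (range q oc<n)
      (subst₂ _<_ (sym (involutive p ob<n)) (sym (involutive q oc<n)) ob<oc)

    descent : ∀ {i j} → 0 < i → i < p → i < j → j < n → f j < f i
    descent {i} {j} 0<i i<p i<j j<n with <-cmp (f j) (f i)
    ... | tri< fj<fi _ _ = fj<fi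
    ... | tri≈ _ e _     = ⊥-elim (<-irrefl (injective (<-trans i<p ob<n) j<n (sym e)) i<j)
    ... | tri> _ _ fi<fj = ⊥-elim (<-irrefl (proj₁ (ascent 0<i i<j j<n fi<fj)) i<p)

    reverse-left-≤ : ∀ {i} → 0 < i → i < p → (∀ {j} → j < i → 0 < j → j < p → f j + j ≡ n) → f i + i ≤ n
    reverse-left-≤ {suc zero}    _ 1<p _ = subst (_≤ n) (+-comm 1 (f 1)) (range 1 (<-trans 1<p ob<n))
    reverse-left-≤ {suc (suc t)} _ i<p ih = begin
      f (2 + t) + (2 + t)      ≡⟨ +-suc (f (2 + t)) (suc t) ⟩
      suc (f (2 + t)) + suc t  ≤⟨ +-monoˡ-≤ (suc t) (descent (s≤s z≤n) (<-trans (n<1+n (suc t)) i<p) (n<1+n (suc t)) (<-trans i<p ob<n)) ⟩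
      f (suc t) + suc t        ≡⟨ ih (n<1+n (suc t)) (s≤s z≤n) (<-trans (n<1+n (suc t)) i<p) ⟩
      n                        ∎
      where open ≤-Reasoning

    module _ {i : ℕ} (0<i : 0 < i) (i<p : i < p) where

      private
        i<n = <-trans i<p ob<n
        v = n ∸ i

        v+i : v + i ≡ n
        v+i = m∸n+n≡m (<⇒≤ i<n)

        v<n : v < n
        v<n = subst (v <_) v+i (m<m+n v 0<i)

        0<v : 0 < v
        0<v = subst (_< v) (n∸n≡0 n) (∸-monoʳ-< i<n ≤-refl)

      -- With v = n − i, the induction hypothesis and the descent below p force f v = i.
      reverse-left-step : (∀ {j} → j < i → 0 < j → j < p → f j + j ≡ n) → f i + i ≡ n
      reverse-left-step ih with <-cmp (f v) i
      ... | tri≈ _ fv≡i _ = trans (cong (λ z → f z + i) (sym fv≡i)) (trans (cong (_+ i) (involutive v v<n)) v+i)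
      ... | tri< fv<i _ _ = ⊥-elim (<-irrefl (+-cancelˡ-≡ v _ _ (begin
              v + f v        ≡⟨ cong (_+ f v) (involutive v v<n) ⟨
              f (f v) + f v  ≡⟨ ih fv<i (positive v<n 0<v) (<-trans fv<i i<p) ⟩
              n              ≡⟨ v+i ⟨
              v + i          ∎)) fv<i)
        where open ≡-Reasoning
      ... | tri> _ _ i<fv = ⊥-elim (≤⇒≯ (reverse-left-≤ 0<i i<p ih) (begin-strict
              n      ≡⟨ v+i ⟨
              v + i  <⟨ +-monoˡ-< i (subst (_< f i) (involutive v v<n) (descent 0<i i<p i<fv (range v v<n))) ⟩
              f i + i ∎))
        where open ≤-Reasoning

  reverse-left : ∀ i → 0 < i → i < p → f i + i ≡ n
  reverse-left = <-rec _ λ i ih 0<i i<p → reverse-left-step 0<i i<p (λ j<i → ih j<i)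

  private
    fix-p = proj₁ fix-p-q
    fix-q = proj₂ fix-p-q

    -- Positions 0 < i < p and their partners n − i are exchanged, so the middle block [p, n − p] is invariant.
    middle-invariant : ∀ {x} → p ≤ x → x + p ≤ n → p ≤ f x
    middle-invariant {x} p≤x x+p≤n with <-cmp (f x) p
    ... | tri> _ _ p<fx = <⇒≤ p<fx
    ... | tri≈ _ fx≡p _ = ≤-reflexive (sym fx≡p)
    ... | tri< fx<p _ _ with f x ≟ 0
    ...   | yes fx≡0 = ⊥-elim (<-irrefl (sym (trans (sym (involutive x x<n)) (trans (cong f fx≡0) f-0))) (<-≤-trans 0<p p≤x))
      where x<n = <-≤-trans (m<m+n x 0<p) x+p≤n
    ...   | no fx≢0 = ⊥-elim (<⇒≱ (+-monoʳ-< x fx<p) (begin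
              x + p      ≤⟨ x+p≤n ⟩
              n          ≡⟨ reverse-left (f x) (≤∧≢⇒< z≤n (fx≢0 ∘ sym)) fx<p ⟨
              f (f x) + f x ≡⟨ cong (_+ f x) (involutive x (<-≤-trans (m<m+n x 0<p) x+p≤n)) ⟩
              x + f x    ∎))
      where open ≤-Reasoning

    q+p≤n : q + p ≤ n
    q+p≤n with ≤-<-connex (q + p) n
    ... | inj₁ q+p≤n = q+p≤n
    ... | inj₂ n<q+p = ⊥-elim (<-irrefl (trans (sym f-q≡i) fix-q) (<-trans i<p ob<oc))
      where
      i = n ∸ q
      i+q : i + q ≡ n
      i+q = m∸n+n≡m (<⇒≤ oc<n)
      i<p : i < p
      i<p = +-cancelʳ-< q i p (subst₂ _<_ (sym i+q) (+-comm q p) n<q+p)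
      f-i≡q : f i ≡ q
      f-i≡q = +-cancelʳ-≡ i (f i) q (trans (reverse-left i (subst (_< i) (n∸n≡0 n) (∸-monoʳ-< oc<n ≤-refl)) i<p)
                                          (trans (sym i+q) (+-comm i q)))
      f-q≡i : f q ≡ i
      f-q≡i = trans (cong f (sym f-i≡q)) (involutive i (<-trans i<p ob<n))

    q≡p+1 : q ≡ suc p
    q≡p+1 with m≤n⇒m<n∨m≡n ob<oc
    ... | inj₂ p+1≡q = sym p+1≡q
    ... | inj₁ p+1<q = ⊥-elim (<-irrefl (proj₂ (ascent 0<p (n<1+n p) (<-trans p+1<q oc<n) p<f[p+1])) p+1<q)
      where
      p<f[p+1] : f p < f (suc p)
      p<f[p+1] = subst (_< f (suc p)) (sym fix-p) (≤∧≢⇒<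
        (middle-invariant (n≤1+n p) (≤-trans (+-monoˡ-≤ p (<⇒≤ p+1<q)) q+p≤n))
        λ p≡f[p+1] → <-irrefl (injective ob<n (<-trans p+1<q oc<n) (trans fix-p p≡f[p+1])) (n<1+n p))

    q+p≡n : q + p ≡ n
    q+p≡n with m≤n⇒m<n∨m≡n q+p≤n
    ... | inj₂ q+p≡n = q+p≡n
    ... | inj₁ q+p<n = ⊥-elim (<-irrefl (sym (proj₁ (ascent 0<q (n<1+n q) q+1<n (subst (_< f (suc q)) (sym fix-q) q<f[q+1])))) ob<oc)
      where
      0<q = <-trans 0<p ob<oc
      q+1<n : suc q < n
      q+1<n = ≤-<-trans (subst (_≤ q + p) (+-comm q 1) (+-monoʳ-≤ q 0<p)) q+p<n
      q<f[q+1] : q < f (suc q)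
      q<f[q+1] = ≤∧≢⇒< (subst (_≤ f (suc q)) (sym q≡p+1)
                          (≤∧≢⇒< (middle-invariant (≤-trans (<⇒≤ ob<oc) (n≤1+n q)) q+p<n)
                                 (misses ob<n fix-p (<-trans ob<oc (n<1+n q)) ∘ sym)))
                       (misses oc<n fix-q (n<1+n q) ∘ sym)
        where
        misses : ∀ {y} → y < n → f y ≡ y → y < suc q → f (suc q) ≢ y
        misses {y} y<n fy≡y y<q+1 e = <-irrefl (injective y<n q+1<n (trans fy≡y (sym e))) y<q+1

    m≡p+p : m ≡ p + p
    m≡p+p = suc-injective (trans (sym q+p≡n) (cong (_+ p) q≡p+1))

    reverse-right : ∀ i → suc p < i → i < n → f i + i ≡ n
    reverse-right i p+1<i i<n = trans (cong (_+ i) f-i≡j) j+i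
      where
      j = n ∸ i
      j+i : j + i ≡ n
      j+i = m∸n+n≡m (<⇒≤ i<n)
      j<p : j < p
      j<p = +-cancelʳ-< i j p (subst₂ _<_ (sym j+i) (+-comm i p)
              (subst (_< i + p) (trans (cong (_+ p) (sym q≡p+1)) q+p≡n) (+-monoˡ-< p p+1<i)))
      0<j : 0 < j
      0<j = subst (_< j) (n∸n≡0 n) (∸-monoʳ-< i<n ≤-refl)
      f-j≡i : f j ≡ i
      f-j≡i = +-cancelʳ-≡ j (f j) i (trans (reverse-left j 0<j j<p) (trans (sym j+i) (+-comm j i)))
      f-i≡j : f i ≡ j
      f-i≡j = trans (cong f (sym f-j≡i)) (involutive j (<-trans j<p ob<n))

  shape : Σ ℕ λ p → m ≡ p + p × 0 < p × FixedZeroShape p f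
  shape = p , m≡p+p , 0<p , record
    { fix-0         = f-0
    ; fix-p         = fix-p
    ; fix-p+1       = subst (λ z → f z ≡ z) q≡p+1 fix-q
    ; reverse-left  = λ i 0<i i<p → subst (f i + i ≡_) (cong suc m≡p+p) (reverse-left i 0<i i<p)
    ; reverse-right = λ i p+1<i i<n → subst (f i + i ≡_) (cong suc m≡p+p)
                                        (reverse-right i p+1<i (subst (i <_) (cong suc (sym m≡p+p)) i<n))
    }

open FixedZeroShape

data Region (p : ℕ) : ℕ → Set where
  at-0   : Region p 0
  left   : ∀ {x} → 0 < x → x < p → Region p x
  at-p   : Region p p
  at-p+1 : Region p (suc p)
  right  : ∀ {x} → suc p < x → Region p x

region : ∀ p x → Region p x
region p zero = at-0
region p (suc x) with <-cmp (suc x) p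
... | tri< x<p _ _ = left (s≤s z≤n) x<p
... | tri≈ _ refl _ = at-p
... | tri> _ _ p<x with <-cmp (suc x) (suc p)
...   | tri< x<p+1 _ _ = ⊥-elim (<⇒≱ p<x (s≤s⁻¹ x<p+1))
...   | tri≈ _ refl _ = at-p+1
...   | tri> _ _ p+1<x = right p+1<x

FixedZeroShape-unique : ∀ {p f g} → FixedZeroShape p f → FixedZeroShape p g → ∀ i → i < suc (p + p) → f i ≡ g i
FixedZeroShape-unique {p} F G i i<n with region p i
... | at-0          = trans (fix-0 F) (sym (fix-0 G))
... | at-p          = trans (fix-p F) (sym (fix-p G))
... | at-p+1        = trans (fix-p+1 F) (sym (fix-p+1 G))
... | left 0<i i<p  = +-cancelʳ-≡ i _ _ (trans (reverse-left F i 0<i i<p) (sym (reverse-left G i 0<i i<p)))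
... | right p+1<i   = +-cancelʳ-≡ i _ _ (trans (reverse-right F i p+1<i i<n) (sym (reverse-right G i p+1<i i<n)))

module FixedZeroShape⇒IsI {p : ℕ} {f : ℕ → ℕ} (0<p : 0 < p) (F : FixedZeroShape p f) where

  private
    n = suc (p + p)

    p<n : p < n
    p<n = s≤s (m≤m+n p p)

    p+1<n : suc p < n
    p+1<n = subst (_< n) (+-comm p 1) (s≤s (+-monoʳ-≤ p 0<p))

    partner-right : ∀ {v x} → v + x ≡ n → x < p → suc p < v
    partner-right {v} {x} e x<p with ≤-<-connex v (suc p)
    ... | inj₂ p+1<v = p+1<v
    ... | inj₁ v≤p+1 = ⊥-elim (<-irrefl e (+-mono-≤-< v≤p+1 x<p))

    partner-left : ∀ {v x} → v + x ≡ n → suc p < x → v < p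
    partner-left {v} {x} e p+1<x with ≤-<-connex p v
    ... | inj₂ v<p = v<p
    ... | inj₁ p≤v = ⊥-elim (<-irrefl (sym e) (subst (_< v + x) (+-suc p p) (+-mono-≤-< p≤v p+1<x)))

    partner<n : ∀ {v x} → v + x ≡ n → 0 < x → v < n
    partner<n {v} e 0<x = subst (v <_) e (m<m+n v 0<x)

    partner-unique : ∀ {v w x} → v + x ≡ n → w + x ≡ n → v ≡ w
    partner-unique {x = x} e e′ = +-cancelʳ-≡ x _ _ (trans e (sym e′))

    partner-antitone : ∀ {a x b y} → a + x ≡ n → b + y ≡ n → x < y → b < a
    partner-antitone {a} {x} {b} {y} e e′ x<y with <-cmp b a
    ... | tri< b<a _ _ = b<a
    ... | tri≈ _ refl _ = ⊥-elim (<-irrefl (+-cancelˡ-≡ b x y (trans e (sym e′))) x<y)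
    ... | tri> _ _ a<b = ⊥-elim (<-irrefl (trans e (sym e′)) (+-mono-< a<b x<y))

    f-range : ∀ i → i < n → f i < n
    f-range i i<n with region p i
    ... | at-0         = subst (_< n) (sym (fix-0 F)) (s≤s z≤n)
    ... | at-p         = subst (_< n) (sym (fix-p F)) p<n
    ... | at-p+1       = subst (_< n) (sym (fix-p+1 F)) p+1<n
    ... | left 0<i i<p = partner<n (reverse-left F i 0<i i<p) 0<i
    ... | right p+1<i  = partner<n (reverse-right F i p+1<i i<n) (≤-<-trans z≤n p+1<i)

    f-involutive : ∀ i → i < n → f (f i) ≡ i
    f-involutive i i<n with region p i
    ... | at-0         = trans (cong f (fix-0 F)) (fix-0 F)
    ... | at-p         = trans (cong f (fix-p F)) (fix-p F)
    ... | at-p+1       = trans (cong f (fix-p+1 F)) (fix-p+1 F)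
    ... | left 0<i i<p =
      let e = reverse-left F i 0<i i<p in
      partner-unique (reverse-right F (f i) (partner-right e i<p) (partner<n e 0<i)) (trans (+-comm i (f i)) e)
    ... | right p+1<i  =
      let e = reverse-right F i p+1<i i<n in
      partner-unique (reverse-left F (f i) (≤∧≢⇒< z≤n λ 0≡fi → <-irrefl (trans (cong (_+ i) 0≡fi) e) i<n)
                                             (partner-left e p+1<i))
                     (trans (+-comm i (f i)) e)

    left-value : ∀ {x} → 0 < x → x < p → suc p < f x
    left-value 0<x x<p = partner-right (reverse-left F _ 0<x x<p) x<p

    right-value : ∀ {x} → suc p < x → x < n → f x < p
    right-value p+1<x x<n = partner-left (reverse-right F _ p+1<x x<n) p+1<x

    only-ascent : ∀ {x y} → 0 < x → x < y → y < n → f x < f y → x ≡ p × y ≡ suc p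
    only-ascent {x} {y} 0<x x<y y<n fx<fy with region p x | region p y
    ... | at-0 | _ = ⊥-elim (<-irrefl refl 0<x)
    ... | _ | at-0 = ⊥-elim (n≮0 (<-trans 0<x x<y))
    ... | left a b | left c d = ⊥-elim (<-asym fx<fy (partner-antitone (reverse-left F x a b) (reverse-left F y c d) x<y))
    ... | left a b | at-p = ⊥-elim (<-asym fx<fy (subst (_< f x) (sym (fix-p F)) (<-trans (n<1+n p) (left-value a b))))
    ... | left a b | at-p+1 = ⊥-elim (<-asym fx<fy (subst (_< f x) (sym (fix-p+1 F)) (left-value a b)))
    ... | left a b | right c = ⊥-elim (<-asym fx<fy (<-trans (right-value c y<n) (<-trans (n<1+n p) (left-value a b))))
    ... | at-p | left _ d = ⊥-elim (<-asym x<y d)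
    ... | at-p | at-p = ⊥-elim (<-irrefl refl x<y)
    ... | at-p | at-p+1 = refl , refl
    ... | at-p | right c = ⊥-elim (<-asym fx<fy (subst (f y <_) (sym (fix-p F)) (right-value c y<n)))
    ... | at-p+1 | left _ d = ⊥-elim (<-asym x<y (<-trans d (n<1+n p)))
    ... | at-p+1 | at-p = ⊥-elim (<-asym x<y (n<1+n p))
    ... | at-p+1 | at-p+1 = ⊥-elim (<-irrefl refl x<y)
    ... | at-p+1 | right c = ⊥-elim (<-asym fx<fy (subst (f y <_) (sym (fix-p+1 F)) (<-trans (right-value c y<n) (n<1+n p))))
    ... | right a | left _ d = ⊥-elim (<-asym x<y (<-trans d (<-trans (n<1+n p) a)))
    ... | right a | at-p = ⊥-elim (<-asym x<y (<-trans (n<1+n p) a))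
    ... | right a | at-p+1 = ⊥-elim (<-asym x<y a)
    ... | right a | right c = ⊥-elim (<-asym fx<fy (partner-antitone (reverse-right F x a (<-trans x<y y<n)) (reverse-right F y c y<n) x<y))

  isI : IsI3412-123 n f
  isI = record
    { range      = f-range
    ; involutive = f-involutive
    ; avoids3412 = avoids
    ; oa = 0 ; ob = p ; oc = suc p
    ; occ        = 0<p , n<1+n p , p+1<n , subst₂ _<_ (sym (fix-0 F)) (sym (fix-p F)) 0<p ,
                   subst₂ _<_ (sym (fix-p F)) (sym (fix-p+1 F)) (n<1+n p)
    ; occ-unique = unique
    }
    where
    unique : ∀ {a b c} → Occ123 n f a b c → a ≡ 0 × b ≡ p × c ≡ suc p
    unique {zero}  (a<b , b<c , c<n , _ , fb<fc) = refl , only-ascent a<b b<c c<n fb<fc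
    unique {suc a} (a<b , b<c , c<n , fa<fb , fb<fc) =
      ⊥-elim (<-irrefl (trans (proj₁ (only-ascent (s≤s z≤n) a<b (<-trans b<c c<n) fa<fb))
                              (sym (proj₁ (only-ascent (≤-<-trans z≤n a<b) b<c c<n fb<fc)))) a<b)
    -- the two ascents c < d and a < b of a 3412 would both have to be p < p + 1
    avoids : ∀ {a b c d} → ¬ Occ3412 n f a b c d
    avoids {zero} (_ , _ , _ , _ , _ , fd<fa , _) = n≮0 (subst (f _ <_) (fix-0 F) fd<fa)
    avoids {suc a} (a<b , b<c , c<d , d<n , fc<fd , _ , fa<fb) =
      let _ , b≡p+1 = only-ascent (s≤s z≤n) a<b (<-trans b<c (<-trans c<d d<n)) fa<fb
          c≡p , _ = only-ascent (≤-<-trans z≤n (<-trans a<b b<c)) c<d d<n fc<fd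
      in <-asym b<c (subst₂ _<_ (sym c≡p) (sym b≡p+1) (n<1+n p))

-- The involutions wrap τ, 1 ⊕ δ and δ ⊕ 1

at-∷ʳ-< : ∀ {k n} (v : Vec (Fin k) n) y {i} → i < n → at (v ∷ʳ y) i ≡ at v i
at-∷ʳ-< (x ∷ v) y {zero}  _         = refl
at-∷ʳ-< (x ∷ v) y {suc i} (s≤s i<n) = at-∷ʳ-< v y i<n

at-∷ʳ-last : ∀ {k n} (v : Vec (Fin k) n) y → at (v ∷ʳ y) n ≡ toℕ y
at-∷ʳ-last []      y = refl
at-∷ʳ-last (x ∷ v) y = at-∷ʳ-last v y

at-map : ∀ {k k′ n} (g : Fin k → Fin k′) (G : ℕ → ℕ) → (∀ x → toℕ (g x) ≡ G (toℕ x)) →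
         (v : Vec (Fin k) n) → ∀ {i} → i < n → at (Vec.map g v) i ≡ G (at v i)
at-map g G g≗G (x ∷ v) {zero}  _         = g≗G x
at-map g G g≗G (x ∷ v) {suc i} (s≤s i<n) = at-map g G g≗G v i<n

at-tabulate : ∀ {k n} (h : Fin n → Fin k) {i} (i<n : i < n) → at (tabulate h) i ≡ toℕ (h (fromℕ< i<n))
at-tabulate h i<n = trans (cong (at (tabulate h)) (sym (toℕ-fromℕ< i<n)))
                          (trans (at-lookup (tabulate h) (fromℕ< i<n)) (cong toℕ (lookup∘tabulate h (fromℕ< i<n))))

double : ℕ → ℕ
double zero    = zero
double (suc c) = suc (suc (double c))

double≡c+c : ∀ c → double c ≡ c + c
double≡c+c zero    = refl
double≡c+c (suc c) = cong suc (trans (cong suc (double≡c+c c)) (sym (+-suc c c)))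

↑ : ∀ {n} → Fin n → Fin (suc (suc n))
↑ x = fs (inject₁ x)

wrap : ∀ {n} → Perm n → Perm (suc (suc n))
wrap {n} τ = fromℕ (suc n) ∷ (Vec.map ↑ τ ∷ʳ fz)

-- For even j, δ j reverses {0, …, j − 1} except that it fixes the two middle points.
δ : (j : ℕ) → Perm j
δ 0                   = []
δ 1                   = fz ∷ []
δ 2                   = fz ∷ fs fz ∷ []
δ (suc (suc (suc k))) = wrap (δ (suc k))

1⊕_ : ∀ {j} → Perm j → Perm (suc j)
1⊕ τ = fz ∷ Vec.map fs τ

_⊕1 : ∀ {j} → Perm j → Perm (suc j)
_⊕1 {j} τ = Vec.map inject₁ τ ∷ʳ fromℕ j

module _ {n : ℕ} (τ : Perm n) where

  wrap-first : at (wrap τ) 0 ≡ suc n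
  wrap-first = toℕ-fromℕ (suc n)

  wrap-last : at (wrap τ) (suc n) ≡ 0
  wrap-last = at-∷ʳ-last (Vec.map ↑ τ) fz

  wrap-inner : ∀ i → i < n → at (wrap τ) (suc i) ≡ suc (at τ i)
  wrap-inner i i<n = trans (at-∷ʳ-< (Vec.map ↑ τ) fz i<n) (at-map ↑ suc (cong suc ∘ toℕ-inject₁) τ i<n)

  wrap-isI : IsI3412-123 n (at τ) → IsI3412-123 (suc (suc n)) (at (wrap τ))
  wrap-isI I = Wrap.isI I (at (wrap τ)) wrap-first wrap-last wrap-inner

wrap-injective : ∀ {n} {τ τ′ : Perm n} → wrap τ ≡ wrap τ′ → τ ≡ τ′
wrap-injective {τ = τ} {τ′} e = at-ext τ τ′ λ i i<n →
  suc-injective (trans (sym (wrap-inner τ i i<n)) (trans (cong (λ v → at v (suc i)) e) (wrap-inner τ′ i i<n)))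

ReversalSymmetric : ∀ {s} → Perm s → Set
ReversalSymmetric {s} τ = ∀ i k → suc (i + k) ≡ s → suc (at τ i + at τ k) ≡ s

wrap-symmetric : ∀ {s} (τ : Perm s) → ReversalSymmetric τ → ReversalSymmetric (wrap τ)
wrap-symmetric {s} τ S zero    zero    ()
wrap-symmetric {s} τ S zero    (suc k) e = cong suc (begin
  at (wrap τ) 0 + at (wrap τ) (suc k)  ≡⟨ cong₂ _+_ (wrap-first τ) (trans (cong (at (wrap τ) ∘ suc) k≡s) (wrap-last τ)) ⟩
  suc s + 0                            ≡⟨ +-identityʳ (suc s) ⟩
  suc s                                ∎)
  where
  open ≡-Reasoning
  k≡s = suc-injective (suc-injective e)
wrap-symmetric {s} τ S (suc i) zero    e = cong suc (begin
  at (wrap τ) (suc i) + at (wrap τ) 0  ≡⟨ cong₂ _+_ (trans (cong (at (wrap τ) ∘ suc) i≡s) (wrap-last τ)) (wrap-first τ) ⟩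
  suc s                                ∎)
  where
  open ≡-Reasoning
  i≡s = trans (sym (+-identityʳ i)) (suc-injective (suc-injective e))
wrap-symmetric {s} τ S (suc i) (suc k) e = begin
  suc (at (wrap τ) (suc i) + at (wrap τ) (suc k))  ≡⟨ cong suc (cong₂ _+_ (wrap-inner τ i i<s) (wrap-inner τ k k<s)) ⟩
  suc (suc (at τ i) + suc (at τ k))                ≡⟨ cong (suc ∘ suc) (+-suc (at τ i) (at τ k)) ⟩
  suc (suc (suc (at τ i + at τ k)))                ≡⟨ cong (suc ∘ suc) (S i k e′) ⟩
  suc (suc s)                                      ∎
  where
  open ≡-Reasoning
  e′ : suc (i + k) ≡ s
  e′ = suc-injective (trans (sym (+-suc (suc i) k)) (suc-injective e))
  i<s = subst (i <_) e′ (s≤s (m≤m+n i k))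
  k<s = subst (k <_) e′ (s≤s (m≤n+m k i))

δ-symmetric : ∀ c → ReversalSymmetric (δ (suc (suc (double c))))
δ-symmetric zero zero          zero          ()
δ-symmetric zero zero          (suc zero)    refl = refl
δ-symmetric zero zero          (suc (suc k)) ()
δ-symmetric zero (suc zero)    zero          refl = refl
δ-symmetric zero (suc zero)    (suc k)       ()
δ-symmetric zero (suc (suc i)) k             ()
δ-symmetric (suc c) = wrap-symmetric (δ (suc (suc (double c)))) (δ-symmetric c)

record MiddleFixedShape (c : ℕ) (g : ℕ → ℕ) : Set where
  field
    fix-c         : g c ≡ c
    fix-c+1       : g (suc c) ≡ suc c
    reverse-below : ∀ i → i < c → g i + i ≡ suc (c + c)
    reverse-above : ∀ i → suc c < i → i < suc (suc (c + c)) → g i + i ≡ suc (c + c)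

open MiddleFixedShape

private
  2+c+c : ∀ c → suc (suc c + suc c) ≡ suc (suc (suc (c + c)))
  2+c+c c = cong (suc ∘ suc) (+-suc c c)

  c+1<2+2c : ∀ c → suc c < suc (suc (double c))
  c+1<2+2c c = s≤s (s≤s (subst (c ≤_) (sym (double≡c+c c)) (m≤m+n c c)))

  c<2+2c : ∀ c → c < suc (suc (double c))
  c<2+2c c = <-trans (n<1+n c) (c+1<2+2c c)

  shifted-sum : ∀ (g h : ℕ → ℕ) {i s} → h (suc i) ≡ suc (g i) → g i + i ≡ s → h (suc i) + suc i ≡ suc (suc s)
  shifted-sum g h {i} hi e = trans (cong (_+ suc i) hi) (trans (cong suc (+-suc (g i) i)) (cong (suc ∘ suc) e))

δ-shape : ∀ c → MiddleFixedShape c (at (δ (suc (suc (double c)))))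
δ-shape zero = record
  { fix-c = refl ; fix-c+1 = refl ; reverse-below = λ _ ()
  ; reverse-above = λ { (suc (suc i)) (s≤s (s≤s _)) (s≤s (s≤s ())) } }
δ-shape (suc c) = record
  { fix-c         = trans (wrap-inner τ c (c<2+2c c)) (cong suc (fix-c D))
  ; fix-c+1       = trans (wrap-inner τ (suc c) (c+1<2+2c c)) (cong suc (fix-c+1 D))
  ; reverse-below = below
  ; reverse-above = above
  }
  where
  τ = δ (suc (suc (double c)))
  D = δ-shape c
  below : ∀ i → i < suc c → at (wrap τ) i + i ≡ suc (suc c + suc c)
  below zero    _         = trans (+-identityʳ _) (trans (wrap-first τ) (trans (cong (suc ∘ suc ∘ suc) (double≡c+c c)) (sym (2+c+c c))))
  below (suc i) (s≤s i<c) = trans (shifted-sum (at τ) (at (wrap τ)) (wrap-inner τ i (<-trans i<c (c<2+2c c))) (reverse-below D i i<c)) (sym (2+c+c c))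
  above : ∀ i → suc (suc c) < i → i < suc (suc (suc c + suc c)) → at (wrap τ) i + i ≡ suc (suc c + suc c)
  above (suc i) (s≤s c+1<i) i<n with m≤n⇒m<n∨m≡n (s≤s⁻¹ (s≤s⁻¹ (subst (suc (suc i) ≤_) (trans (cong suc (2+c+c c)) (cong (suc ∘ suc ∘ suc ∘ suc) (sym (double≡c+c c)))) i<n)))
  ... | inj₂ refl = trans (cong (_+ suc (suc (suc (double c)))) (wrap-last τ)) (trans (cong (suc ∘ suc ∘ suc) (double≡c+c c)) (sym (2+c+c c)))
  ... | inj₁ i<s  = trans (shifted-sum (at τ) (at (wrap τ)) (wrap-inner τ i i<s)
                            (reverse-above D i c+1<i (subst (i <_) (cong (suc ∘ suc) (double≡c+c c)) i<s)))
                          (sym (2+c+c c))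

1⊕-inner : ∀ {j} (τ : Perm j) {i} → i < j → at (1⊕ τ) (suc i) ≡ suc (at τ i)
1⊕-inner τ = at-map fs suc (λ _ → refl) τ

⊕1-inner : ∀ {j} (τ : Perm j) {i} → i < j → at (τ ⊕1) i ≡ at τ i
⊕1-inner τ i<j = trans (at-∷ʳ-< (Vec.map inject₁ τ) _ i<j) (at-map inject₁ (λ z → z) toℕ-inject₁ τ i<j)

⊕1-last : ∀ {j} (τ : Perm j) → at (τ ⊕1) j ≡ j
⊕1-last {j} τ = trans (at-∷ʳ-last (Vec.map inject₁ τ) (fromℕ j)) (toℕ-fromℕ j)

module _ (c : ℕ) where

  private
    j = suc (suc (double c))

  length-1⊕δ : suc (suc c + suc c) ≡ suc j
  length-1⊕δ = trans (2+c+c c) (cong (suc ∘ suc ∘ suc) (sym (double≡c+c c)))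

  1⊕δ-shape : FixedZeroShape (suc c) (at (1⊕ δ j))
  1⊕δ-shape = record
    { fix-0         = refl
    ; fix-p         = trans (1⊕-inner (δ j) (c<2+2c c)) (cong suc (fix-c D))
    ; fix-p+1       = trans (1⊕-inner (δ j) (c+1<2+2c c)) (cong suc (fix-c+1 D))
    ; reverse-left  = λ where
        (suc i) _ (s≤s i<c) → trans (shifted-sum (at (δ j)) (at (1⊕ δ j)) (1⊕-inner (δ j) (<-trans i<c (c<2+2c c)))
                                                 (reverse-below D i i<c)) (sym (2+c+c c))
    ; reverse-right = λ where
        (suc i) (s≤s c+1<i) i<n →
          let i<2+c+c = s≤s⁻¹ (subst (suc (suc i) ≤_) (2+c+c c) i<n) in
          trans (shifted-sum (at (δ j)) (at (1⊕ δ j)) (1⊕-inner (δ j) (subst (i <_) (sym (cong (suc ∘ suc) (double≡c+c c))) i<2+c+c))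
                             (reverse-above D i c+1<i i<2+c+c)) (sym (2+c+c c))
    }
    where D = δ-shape c

  1⊕δ-isI : IsI3412-123 (suc j) (at (1⊕ δ j))
  1⊕δ-isI = subst (λ n → IsI3412-123 n (at (1⊕ δ j))) length-1⊕δ (FixedZeroShape⇒IsI.isI (s≤s z≤n) 1⊕δ-shape)

  -- δ j ⊕ 1 is the reverse-complement of 1 ⊕ δ j because δ j commutes with the reversal.
  ⊕1-complements-1⊕ : ∀ i k → i + k ≡ j → at (δ j ⊕1) i + at (1⊕ δ j) k ≡ j
  ⊕1-complements-1⊕ i zero    e = trans (+-identityʳ _) (trans (cong (at (δ j ⊕1)) (trans (sym (+-identityʳ i)) e)) (⊕1-last (δ j)))
  ⊕1-complements-1⊕ i (suc k) e = trans (cong₂ _+_ (⊕1-inner (δ j) i<j) (1⊕-inner (δ j) k<j))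
                                          (trans (+-suc _ _) (δ-symmetric c i k e′))
    where
    e′ : suc (i + k) ≡ j
    e′ = trans (sym (+-suc i k)) e
    i<j = subst (i <_) e′ (s≤s (m≤m+n i k))
    k<j = subst (k <_) e′ (s≤s (m≤n+m k i))

  ⊕1-as-complement : ∀ i → i ≤ j → at (δ j ⊕1) i ≡ j ∸ at (1⊕ δ j) (j ∸ i)
  ⊕1-as-complement i i≤j = trans (sym (m+n∸n≡m (at (δ j ⊕1) i) (at (1⊕ δ j) (j ∸ i))))
                                 (cong (_∸ at (1⊕ δ j) (j ∸ i)) (⊕1-complements-1⊕ i (j ∸ i) (m+[n∸m]≡n i≤j)))

  δ⊕1-isI : IsI3412-123 (suc j) (at (δ j ⊕1))
  δ⊕1-isI = IsI-cong (ReverseComplement.isI 1⊕δ-isI) λ i i<n → sym (⊕1-as-complement i (s≤s⁻¹ i<n))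

-- The enumeration

even-double : ∀ c → evenᵇ (double c) ≡ true
even-double zero    = refl
even-double (suc c) = cong (not ∘ not) (even-double c)

odd⇒suc-double : ∀ k → evenᵇ k ≡ false → Σ ℕ λ c → k ≡ suc (double c)
odd⇒suc-double (suc zero)    _ = 0 , refl
odd⇒suc-double (suc (suc k)) e =
  let c , k≡ = odd⇒suc-double k (trans (sym (not-involutive (evenᵇ k))) e) in suc c , cong (suc ∘ suc) k≡

fixedCornerOdd : ∀ k → Bool → List (Perm (suc (suc (suc (suc k)))))
fixedCornerOdd k true  = []
fixedCornerOdd k false = 1⊕ δ (suc (suc (suc k))) ∷ δ (suc (suc (suc k))) ⊕1 ∷ []

-- The members of length j + 1 fixing 0 or j: 1 ⊕ δ j and δ j ⊕ 1 for even j, which coincide for j = 2.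
fixedCorner : (j : ℕ) → List (Perm (suc j))
fixedCorner 0                   = []
fixedCorner 1                   = []
fixedCorner 2                   = 1⊕ δ 2 ∷ []
fixedCorner (suc (suc (suc k))) = fixedCornerOdd k (evenᵇ k)

enumerate : (n : ℕ) → List (Perm n)
enumerate 0             = []
enumerate 1             = []
enumerate (suc (suc n)) = List.map wrap (enumerate n) ++ fixedCorner (suc n)

1⊕δ∈fixedCorner : ∀ c → 1⊕ δ (suc (suc (double c))) ∈ fixedCorner (suc (suc (double c)))
1⊕δ∈fixedCorner zero = here refl
1⊕δ∈fixedCorner (suc c) rewrite even-double c = here refl

δ⊕1∈fixedCorner : ∀ c → δ (suc (suc (double c))) ⊕1 ∈ fixedCorner (suc (suc (double c)))
δ⊕1∈fixedCorner zero = here refl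
δ⊕1∈fixedCorner (suc c) rewrite even-double c = there (here refl)

fixedCorner-isI : ∀ j {π} → π ∈ fixedCorner j → IsI3412-123 (suc j) (at π)
fixedCorner-isI 2 (here refl) = 1⊕δ-isI 0
fixedCorner-isI (suc (suc (suc k))) π∈ with evenᵇ k in e
... | false with odd⇒suc-double k e
...   | c , refl with π∈
...     | here refl         = 1⊕δ-isI (suc c)
...     | there (here refl) = δ⊕1-isI (suc c)

unwrap : ∀ {n} (π : Perm (suc (suc n))) → IsI3412-123 (suc (suc n)) (at π) → at π 0 ≡ suc n →
         Σ (Perm n) λ τ → π ≡ wrap τ × IsI3412-123 n (at τ)
unwrap {n} π I π0 = τ , at-ext π (wrap τ) agree , IsI-cong U.isI (λ i i<n → sym (at-τ i<n))
  where
  module U = Unwrap I π0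
  τ : Perm n
  τ = tabulate (λ i → fromℕ< (U.g<m (toℕ i) (toℕ<n i)))
  at-τ : ∀ {i} → i < n → at τ i ≡ U.g i
  at-τ i<n = trans (at-tabulate _ i<n) (trans (toℕ-fromℕ< _) (cong U.g (toℕ-fromℕ< i<n)))
  agree : ∀ i → i < suc (suc n) → at π i ≡ at (wrap τ) i
  agree i i<n with position n i<n
  ... | first     = trans π0 (sym (wrap-first τ))
  ... | last      = trans U.f-last (sym (wrap-last τ))
  ... | inner i<n = trans (U.f-inner i<n) (trans (cong suc (sym (at-τ i<n))) (sym (wrap-inner τ _ i<n)))

fixed-0⇒fixedCorner : ∀ c (π : Perm (suc (suc (suc (double c))))) →
                      FixedZeroShape (suc c) (at π) → π ∈ fixedCorner (suc (suc (double c)))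
fixed-0⇒fixedCorner c π F = subst (_∈ fixedCorner _) (sym π≡) (1⊕δ∈fixedCorner c)
  where
  π≡ : π ≡ 1⊕ δ (suc (suc (double c)))
  π≡ = at-ext π _ λ i i<n → FixedZeroShape-unique F (1⊕δ-shape c) i (subst (i <_) (sym (length-1⊕δ c)) i<n)

fixed-last⇒fixedCorner : ∀ c (π : Perm (suc (suc (suc (double c))))) (I : IsI3412-123 (suc (suc (suc (double c)))) (at π)) →
                         FixedZeroShape (suc c) (ReverseComplement.rc I) → π ∈ fixedCorner (suc (suc (double c)))
fixed-last⇒fixedCorner c π I F = subst (_∈ fixedCorner _) (sym π≡) (δ⊕1∈fixedCorner c)
  where
  j = suc (suc (double c))
  open Properties I
  π≡ : π ≡ δ j ⊕1
  π≡ = at-ext π _ λ i i<n →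
    let πi≤j = s≤s⁻¹ (range i i<n) in begin
      at π i                            ≡⟨ m∸[m∸n]≡n πi≤j ⟨
      j ∸ (j ∸ at π i)                  ≡⟨ cong (λ k → j ∸ (j ∸ at π k)) (m∸[m∸n]≡n (s≤s⁻¹ i<n)) ⟨
      j ∸ ReverseComplement.rc I (j ∸ i) ≡⟨ cong (j ∸_) (FixedZeroShape-unique F (1⊕δ-shape c) (j ∸ i)
                                                           (subst (j ∸ i <_) (sym (length-1⊕δ c)) (s≤s (m∸n≤m j i)))) ⟩
      j ∸ at (1⊕ δ j) (j ∸ i)           ≡⟨ ⊕1-as-complement c i (s≤s⁻¹ i<n) ⟨
      at (δ j ⊕1) i                     ∎
    where open ≡-Reasoning

private
  p+p≡1+double : ∀ {n c} → suc n ≡ suc c + suc c → n ≡ suc (double c)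
  p+p≡1+double {c = c} e = suc-injective (trans e (cong suc (trans (+-suc c c) (cong suc (sym (double≡c+c c))))))

  via-fixed-0 : ∀ n (π : Perm (suc (suc n))) → (Σ ℕ λ p → suc n ≡ p + p × 0 < p × FixedZeroShape p (at π)) →
                π ∈ fixedCorner (suc n)
  via-fixed-0 n π (suc c , e , _ , F) with p+p≡1+double e
  ... | refl = fixed-0⇒fixedCorner c π F

  via-fixed-last : ∀ n (π : Perm (suc (suc n))) (I : IsI3412-123 (suc (suc n)) (at π)) →
                   (Σ ℕ λ p → suc n ≡ p + p × 0 < p × FixedZeroShape p (ReverseComplement.rc I)) →
                   π ∈ fixedCorner (suc n)
  via-fixed-last n π I (suc c , e , _ , F) with p+p≡1+double e
  ... | refl = fixed-last⇒fixedCorner c π I F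

complete : ∀ n (π : Perm n) → IsI3412-123 n (at π) → π ∈ enumerate n
complete 0 π I = ⊥-elim (n≮0 (Properties.3≤n I))
complete 1 π I = ⊥-elim (n≮0 (s≤s⁻¹ (Properties.3≤n I)))
complete (suc (suc n)) π I with Corners.corners I
... | inj₁ π0≡n+1 =
  let τ , π≡ , Iτ = unwrap π I π0≡n+1 in
  ∈-++⁺ˡ (subst (_∈ List.map wrap (enumerate n)) (sym π≡) (∈-map⁺ wrap (complete n τ Iτ)))
... | inj₂ (inj₁ π0≡0) = ∈-++⁺ʳ _ (via-fixed-0 n π (FixedZero.shape I π0≡0))
... | inj₂ (inj₂ πlast≡last) = ∈-++⁺ʳ _ (via-fixed-last n π I (FixedZero.shape (ReverseComplement.isI I) rc0≡0))
  where
  rc0≡0 : ReverseComplement.rc I 0 ≡ 0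
  rc0≡0 = trans (cong (suc n ∸_) πlast≡last) (n∸n≡0 (suc n))

sound : ∀ n (π : Perm n) → π ∈ enumerate n → IsI3412-123 n (at π)
sound (suc (suc n)) π π∈ with ∈-++⁻ (List.map wrap (enumerate n)) π∈
... | inj₂ π∈′ = fixedCorner-isI (suc n) π∈′
... | inj₁ π∈′ with ∈-map⁻ wrap π∈′
...   | τ , τ∈ , refl = wrap-isI τ (sound n τ τ∈)

fixedCorner-first< : ∀ j {π} → π ∈ fixedCorner j → at π 0 < j
fixedCorner-first< 2 (here refl) = s≤s z≤n
fixedCorner-first< (suc (suc (suc k))) π∈ with evenᵇ k
... | false with π∈
...   | here refl         = s≤s z≤n
...   | there (here refl) = subst (_< suc (suc (suc k))) (sym (⊕1-inner (δ (suc (suc (suc k)))) (s≤s z≤n)))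
                              (at< (δ (suc (suc (suc k)))) 0 (s≤s z≤n))

fixedCorner-unique : ∀ j → Unique (fixedCorner j)
fixedCorner-unique 0 = []
fixedCorner-unique 1 = []
fixedCorner-unique 2 = All.[] ∷ []
fixedCorner-unique (suc (suc (suc k))) with evenᵇ k
... | true  = []
... | false = (1⊕≢⊕1 All.∷ All.[]) ∷ All.[] ∷ []
  where
  j = suc (suc (suc k))
  1⊕≢⊕1 : 1⊕ δ j ≢ δ j ⊕1
  1⊕≢⊕1 e with trans (cong (λ v → at v 0) e) (trans (⊕1-inner (δ j) (s≤s z≤n)) (wrap-first (δ (suc k))))
  ... | ()

enumerate-unique : ∀ n → Unique (enumerate n)
enumerate-unique 0             = []
enumerate-unique 1             = []
enumerate-unique (suc (suc n)) =
  ++⁺ (map⁺ wrap-injective (enumerate-unique n)) (fixedCorner-unique (suc n)) λ (w∈ , c∈) →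
    let τ , _ , π≡ = ∈-map⁻ wrap w∈ in
    <-irrefl (trans (cong (λ v → at v 0) π≡) (wrap-first τ)) (fixedCorner-first< (suc n) c∈)

I3412-123↭enumerate : ∀ n → I3412-123 n ↭ enumerate n
I3412-123↭enumerate n = ∼bag⇒↭ (unique∧set⇒bag (filter⁺ (T? ∘ isI3412-123) (allVecs-unique n n)) (enumerate-unique n)
  (λ {π} → mk⇔ (λ π∈ → complete n π (T-isI⇒IsI π (proj₂ (∈-filter⁻ (T? ∘ isI3412-123) {xs = allVecs n n} π∈))))
                (λ π∈ → ∈-filter⁺ (T? ∘ isI3412-123) (∈-allVecs π) (IsI⇒T-isI π (sound n π π∈)))))

-- Inversions and signs

bit : Bool → ℕ
bit true  = 1
bit false = 0

trues : List Bool → ℕ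
trues bs = length (filterᵇ (λ b → b) bs)

trues-++ : ∀ bs cs → trues (bs ++ cs) ≡ trues bs + trues cs
trues-++ []           cs = refl
trues-++ (true ∷ bs)  cs = cong suc (trues-++ bs cs)
trues-++ (false ∷ bs) cs = trues-++ bs cs

∑ : ∀ n → (Fin n → ℕ) → ℕ
∑ zero    h = 0
∑ (suc n) h = h fz + ∑ n (h ∘ fs)

∑-cong : ∀ n {h h′ : Fin n → ℕ} → (∀ i → h i ≡ h′ i) → ∑ n h ≡ ∑ n h′
∑-cong zero    _   = refl
∑-cong (suc n) h≗h′ = cong₂ _+_ (h≗h′ fz) (∑-cong n (h≗h′ ∘ fs))

trues-map-tabulate : ∀ {A : Set} n (g : A → Bool) (h : Fin n → A) → trues (map g (List.tabulate h)) ≡ ∑ n (bit ∘ g ∘ h)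
trues-map-tabulate zero    g h = refl
trues-map-tabulate (suc n) g h with g (h fz)
... | true  = cong suc (trues-map-tabulate n g (h ∘ fs))
... | false = trues-map-tabulate n g (h ∘ fs)

trues-concatMap-tabulate : ∀ {A : Set} n (ψ : A → List Bool) (h : Fin n → A) →
                           trues (List.concatMap ψ (List.tabulate h)) ≡ ∑ n (trues ∘ ψ ∘ h)
trues-concatMap-tabulate zero    ψ h = refl
trues-concatMap-tabulate (suc n) ψ h =
  trans (trues-++ (ψ (h fz)) _) (cong (_+_ (trues (ψ (h fz)))) (trues-concatMap-tabulate n ψ (h ∘ fs)))

inverted : ∀ {k n} → Vec (Fin k) n → Fin n → Fin n → Bool
inverted v i j = (toℕ i <ᵇ toℕ j) ∧ (toℕ (lookup v j) <ᵇ toℕ (lookup v i))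

below : ∀ {k n} → Fin k → Vec (Fin k) n → ℕ
below x []      = 0
below x (y ∷ v) = bit (toℕ y <ᵇ toℕ x) + below x v

above : ∀ {k n} → Fin k → Vec (Fin k) n → ℕ
above x []      = 0
above x (y ∷ v) = bit (toℕ x <ᵇ toℕ y) + above x v

invCount : ∀ {k n} → Vec (Fin k) n → ℕ
invCount []      = 0
invCount (x ∷ v) = below x v + invCount v

∑-below : ∀ {k n} (x : Fin k) (v : Vec (Fin k) n) → ∑ n (λ j → bit (toℕ (lookup v j) <ᵇ toℕ x)) ≡ below x v
∑-below x []      = refl
∑-below x (y ∷ v) = cong (_+_ (bit (toℕ y <ᵇ toℕ x))) (∑-below x v)

∑∑-inverted : ∀ {k n} (v : Vec (Fin k) n) → ∑ n (λ i → ∑ n (bit ∘ inverted v i)) ≡ invCount v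
∑∑-inverted []      = refl
∑∑-inverted (x ∷ v) = cong₂ _+_ (∑-below x v) (∑∑-inverted v)

inversions≡invCount : ∀ {n} (π : Perm n) → inversions π ≡ invCount π
inversions≡invCount {n} π = begin
  inversions π                                 ≡⟨ trues-concatMap-tabulate n (λ i → map (inverted π i) (allFin n)) id ⟩
  ∑ n (λ i → trues (map (inverted π i) (allFin n))) ≡⟨ ∑-cong n (λ i → trues-map-tabulate n (inverted π i) id) ⟩
  ∑ n (λ i → ∑ n (bit ∘ inverted π i))         ≡⟨ ∑∑-inverted π ⟩
  invCount π                                   ∎
  where open ≡-Reasoning

<⇒<ᵇ≡true : ∀ {x y} → x < y → (x <ᵇ y) ≡ true
<⇒<ᵇ≡true = Equivalence.to T-≡ ∘ <⇒<ᵇ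

≤⇒<ᵇ≡false : ∀ {x y} → y ≤ x → (x <ᵇ y) ≡ false
≤⇒<ᵇ≡false y≤x = Equivalence.to T-not-≡ (implies⇒T-∨-not {false} (≤⇒≯ y≤x ∘ <ᵇ⇒< _ _))

below-∷ʳ : ∀ {k n} (x : Fin k) (v : Vec (Fin k) n) y → below x (v ∷ʳ y) ≡ below x v + bit (toℕ y <ᵇ toℕ x)
below-∷ʳ x []      y = +-identityʳ _
below-∷ʳ x (z ∷ v) y = trans (cong (_+_ (bit (toℕ z <ᵇ toℕ x))) (below-∷ʳ x v y)) (sym (+-assoc (bit (toℕ z <ᵇ toℕ x)) _ _))

invCount-∷ʳ : ∀ {k n} (v : Vec (Fin k) n) y → invCount (v ∷ʳ y) ≡ invCount v + above y v
invCount-∷ʳ []      y = refl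
invCount-∷ʳ (x ∷ v) y = trans (cong₂ _+_ (below-∷ʳ x v y) (invCount-∷ʳ v y)) (interchange (below x v) _ (invCount v) _)
  where
  interchange : ∀ a b c d → (a + b) + (c + d) ≡ (a + c) + (b + d)
  interchange = solve-∀

module _ {k k′ : ℕ} (g : Fin k → Fin k′) (g-mono : ∀ a b → (toℕ (g a) <ᵇ toℕ (g b)) ≡ (toℕ a <ᵇ toℕ b)) where

  below-map : ∀ {n} x (v : Vec (Fin k) n) → below (g x) (Vec.map g v) ≡ below x v
  below-map x []      = refl
  below-map x (y ∷ v) = cong₂ _+_ (cong bit (g-mono y x)) (below-map x v)

  invCount-map : ∀ {n} (v : Vec (Fin k) n) → invCount (Vec.map g v) ≡ invCount v
  invCount-map []      = refl
  invCount-map (x ∷ v) = cong₂ _+_ (below-map x v) (invCount-map v)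

↑-mono : ∀ {n} (a b : Fin n) → (toℕ (↑ a) <ᵇ toℕ (↑ b)) ≡ (toℕ a <ᵇ toℕ b)
↑-mono a b = cong₂ _<ᵇ_ (toℕ-inject₁ a) (toℕ-inject₁ b)

inject₁-mono : ∀ {n} (a b : Fin n) → (toℕ (inject₁ a) <ᵇ toℕ (inject₁ b)) ≡ (toℕ a <ᵇ toℕ b)
inject₁-mono a b = cong₂ _<ᵇ_ (toℕ-inject₁ a) (toℕ-inject₁ b)

below-top : ∀ {n m} (τ : Vec (Fin n) m) → below (fromℕ (suc n)) (Vec.map ↑ τ) ≡ m
below-top []          = refl
below-top {n} (y ∷ τ) = cong₂ _+_ (cong bit (trans (cong₂ _<ᵇ_ (toℕ-inject₁ y) (toℕ-fromℕ n)) (<⇒<ᵇ≡true (toℕ<n y)))) (below-top τ)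

above-bottom : ∀ {n m} (τ : Vec (Fin n) m) → above fz (Vec.map ↑ τ) ≡ m
above-bottom []      = refl
above-bottom (y ∷ τ) = cong suc (above-bottom τ)

below-bottom : ∀ {n m} (v : Vec (Fin n) m) → below fz (Vec.map fs v) ≡ 0
below-bottom []      = refl
below-bottom (y ∷ v) = below-bottom v

above-top : ∀ {j m} (v : Vec (Fin j) m) → above (fromℕ j) (Vec.map inject₁ v) ≡ 0
above-top []          = refl
above-top {j} (y ∷ v) = cong₂ _+_ (cong bit (trans (cong₂ _<ᵇ_ (toℕ-fromℕ j) (toℕ-inject₁ y)) (≤⇒<ᵇ≡false (<⇒≤ (toℕ<n y)))))
                                   (above-top v)

invCount-wrap : ∀ {n} (τ : Perm n) → invCount (wrap τ) ≡ suc (n + n + invCount τ)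
invCount-wrap {n} τ = begin
  below (fromℕ (suc n)) (Vec.map ↑ τ ∷ʳ fz) + invCount (Vec.map ↑ τ ∷ʳ fz)
    ≡⟨ cong₂ _+_ (below-∷ʳ (fromℕ (suc n)) (Vec.map ↑ τ) fz) (invCount-∷ʳ (Vec.map ↑ τ) fz) ⟩
  (below (fromℕ (suc n)) (Vec.map ↑ τ) + 1) + (invCount (Vec.map ↑ τ) + above fz (Vec.map ↑ τ))
    ≡⟨ cong₂ (λ a b → (a + 1) + b) (below-top τ) (cong₂ _+_ (invCount-map ↑ ↑-mono τ) (above-bottom τ)) ⟩
  (n + 1) + (invCount τ + n)
    ≡⟨ rearrange n (invCount τ) ⟩
  suc (n + n + invCount τ) ∎
  where
  open ≡-Reasoning
  rearrange : ∀ n k → (n + 1) + (k + n) ≡ suc (n + n + k)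
  rearrange = solve-∀

invCount-1⊕ : ∀ {j} (τ : Perm j) → invCount (1⊕ τ) ≡ invCount τ
invCount-1⊕ τ = cong₂ _+_ (below-bottom τ) (invCount-map fs (λ _ _ → refl) τ)

invCount-⊕1 : ∀ {j} (τ : Perm j) → invCount (τ ⊕1) ≡ invCount τ
invCount-⊕1 {j} τ = trans (invCount-∷ʳ (Vec.map inject₁ τ) (fromℕ j))
                          (trans (cong₂ _+_ (invCount-map inject₁ inject₁-mono τ) (above-top τ)) (+-identityʳ _))

parity-sign : ℕ → ℤ
parity-sign k = if evenᵇ k then + 1 else - (+ 1)

sign≡parity-sign : ∀ {n} (π : Perm n) → sign π ≡ parity-sign (invCount π)
sign≡parity-sign π = cong parity-sign (inversions≡invCount π)

evenᵇ-double+ : ∀ n k → evenᵇ (n + n + k) ≡ evenᵇ k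
evenᵇ-double+ zero    k = refl
evenᵇ-double+ (suc n) k = trans (cong (evenᵇ ∘ suc) (cong (_+ k) (+-suc n n))) (trans (not-involutive _) (evenᵇ-double+ n k))

parity-sign-odd-shift : ∀ n k → parity-sign (suc (n + n + k)) ≡ - parity-sign k
parity-sign-odd-shift n k rewrite evenᵇ-double+ n k with evenᵇ k
... | true  = refl
... | false = refl

sign-wrap : ∀ {n} (τ : Perm n) → sign (wrap τ) ≡ - sign τ
sign-wrap {n} τ = begin
  sign (wrap τ)                            ≡⟨ sign≡parity-sign (wrap τ) ⟩
  parity-sign (invCount (wrap τ))          ≡⟨ cong parity-sign (invCount-wrap τ) ⟩
  parity-sign (suc (n + n + invCount τ))   ≡⟨ parity-sign-odd-shift n (invCount τ) ⟩
  - parity-sign (invCount τ)               ≡⟨ cong -_ (sign≡parity-sign τ) ⟨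
  - sign τ                                 ∎
  where open ≡-Reasoning

sign-1⊕ : ∀ {j} (τ : Perm j) → sign (1⊕ τ) ≡ sign τ
sign-1⊕ τ = trans (sign≡parity-sign (1⊕ τ)) (trans (cong parity-sign (invCount-1⊕ τ)) (sym (sign≡parity-sign τ)))

sign-⊕1 : ∀ {j} (τ : Perm j) → sign (τ ⊕1) ≡ sign τ
sign-⊕1 τ = trans (sign≡parity-sign (τ ⊕1)) (trans (cong parity-sign (invCount-⊕1 τ)) (sym (sign≡parity-sign τ)))

-- Counting

signSum : ∀ {n} → List (Perm n) → ℤ
signSum = List.foldr (λ π acc → sign π +ℤ acc) (+ 0)

signSum-↭ : ∀ {n} {xs ys : List (Perm n)} → xs ↭ ys → signSum xs ≡ signSum ys
signSum-↭ ↭.refl          = refl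
signSum-↭ (↭.prep π p)    = cong (sign π +ℤ_) (signSum-↭ p)
signSum-↭ (↭.swap π σ p)  = trans (swap-heads (sign π) (sign σ) _) (cong (λ s → sign σ +ℤ (sign π +ℤ s)) (signSum-↭ p))
  where
  swap-heads : ∀ a b s → a +ℤ (b +ℤ s) ≡ b +ℤ (a +ℤ s)
  swap-heads = ℤ-Solver.solve-∀
signSum-↭ (↭.trans p q)   = trans (signSum-↭ p) (signSum-↭ q)

signSum-++ : ∀ {n} (xs ys : List (Perm n)) → signSum (xs ++ ys) ≡ signSum xs +ℤ signSum ys
signSum-++ []       ys = sym (ℤ.+-identityˡ _)
signSum-++ (π ∷ xs) ys = trans (cong (sign π +ℤ_) (signSum-++ xs ys)) (sym (ℤ.+-assoc (sign π) _ _))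

signSum-wrap : ∀ {n} (xs : List (Perm n)) → signSum (List.map wrap xs) ≡ - signSum xs
signSum-wrap []       = refl
signSum-wrap (π ∷ xs) = trans (cong₂ _+ℤ_ (sign-wrap π) (signSum-wrap xs)) (sym (ℤ.neg-distrib-+ (sign π) _))

count : ℕ → ℕ
count n = length (enumerate n)

signedCount : ℕ → ℤ
signedCount n = signSum (enumerate n)

gPlus≡count : ∀ n → gPlus n ≡ + count n
gPlus≡count n = cong +_ (↭-length (I3412-123↭enumerate n))

gMinus≡signedCount : ∀ n → gMinus n ≡ signedCount n
gMinus≡signedCount n = signSum-↭ (I3412-123↭enumerate n)

count-step : ∀ n → count (suc (suc n)) ≡ count n + length (fixedCorner (suc n))
count-step n = trans (length-++ (List.map wrap (enumerate n)))
                     (cong (_+ length (fixedCorner (suc n))) (length-map wrap (enumerate n)))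

signedCount-step : ∀ n → signedCount (suc (suc n)) ≡ - signedCount n +ℤ signSum (fixedCorner (suc n))
signedCount-step n = trans (signSum-++ (List.map wrap (enumerate n)) _)
                           (cong (_+ℤ signSum (fixedCorner (suc n))) (signSum-wrap (enumerate n)))

fixedCorner-length-periodic : ∀ k → length (fixedCorner (5 + k)) ≡ length (fixedCorner (3 + k))
fixedCorner-length-periodic k with evenᵇ k
... | true  = refl
... | false = refl

-- δ (j + 2) = wrap (δ j), so both fixed-corner permutations change sign when j grows by 2.
fixedCorner-signSum-antiperiodic : ∀ k → signSum (fixedCorner (5 + k)) ≡ - signSum (fixedCorner (3 + k))
fixedCorner-signSum-antiperiodic k with evenᵇ k
... | true  = refl
... | false = begin
  sign (1⊕ δ (5 + k)) +ℤ (sign (δ (5 + k) ⊕1) +ℤ + 0)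
    ≡⟨ cong₂ (λ a b → a +ℤ (b +ℤ + 0)) (trans (sign-1⊕ (δ (5 + k))) (sign-wrap (δ (3 + k))))
                                       (trans (sign-⊕1 (δ (5 + k))) (sign-wrap (δ (3 + k)))) ⟩
  - sign (δ (3 + k)) +ℤ (- sign (δ (3 + k)) +ℤ + 0)
    ≡⟨ cong₂ (λ a b → - a +ℤ (- b +ℤ + 0)) (sign-1⊕ (δ (3 + k))) (sign-⊕1 (δ (3 + k))) ⟨
  - sign (1⊕ δ (3 + k)) +ℤ (- sign (δ (3 + k) ⊕1) +ℤ + 0)
    ≡⟨ negate-sum (sign (1⊕ δ (3 + k))) (sign (δ (3 + k) ⊕1)) ⟩
  - (sign (1⊕ δ (3 + k)) +ℤ (sign (δ (3 + k) ⊕1) +ℤ + 0))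
    ∎
  where
  open ≡-Reasoning
  negate-sum : ∀ a b → - a +ℤ (- b +ℤ + 0) ≡ - (a +ℤ (b +ℤ + 0))
  negate-sum = ℤ-Solver.solve-∀

mulPS-cong : ∀ p {f g : ℕ → ℤ} → (∀ i → f i ≡ g i) → ∀ n → mulPS p f n ≡ mulPS p g n
mulPS-cong []      f≗g n       = refl
mulPS-cong (a ∷ p) f≗g zero    = cong (a *ℤ_) (f≗g zero)
mulPS-cong (a ∷ p) f≗g (suc n) = cong₂ _+ℤ_ (cong (a *ℤ_) (f≗g (suc n))) (mulPS-cong p f≗g n)

-- For n ≥ 6 the right-hand coefficient is 0 and the left-hand one is f n − 2 f (n − 2) + f (n − 4).
G⁺-identity : ∀ n → mulPS (ppow (padd (pconst (+ 1)) (pmul (pconst (- (+ 1))) (ppow X 2))) 2) (λ i → + count i) n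
                    ≡ coeff (pmul (ppow X 3) (padd (pconst (+ 1)) (ppow X 2))) n
G⁺-identity 0 = refl
G⁺-identity 1 = refl
G⁺-identity 2 = refl
G⁺-identity 3 = refl
G⁺-identity 4 = refl
G⁺-identity 5 = refl
G⁺-identity (suc (suc (suc (suc (suc (suc k)))))) =
  trans (cong₂ (λ u v → + 1 *ℤ u +ℤ (+ 0 *ℤ + count (5 + k) +ℤ (-[1+ 1 ] *ℤ v +ℤ (+ 0 *ℤ + count (3 + k) +ℤ (+ 1 *ℤ + count (2 + k) +ℤ + 0)))))
               count-6+k count-4+k)
        (second-difference (+ count (2 + k)) (+ e) (+ count (5 + k)) (+ count (3 + k)))
  where
  e = length (fixedCorner (3 + k))
  count-4+k : + count (4 + k) ≡ + count (2 + k) +ℤ + e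
  count-4+k = trans (cong +_ (count-step (2 + k))) (ℤ.pos-+ (count (2 + k)) e)
  count-6+k : + count (6 + k) ≡ (+ count (2 + k) +ℤ + e) +ℤ + e
  count-6+k = trans (cong +_ (count-step (4 + k)))
                    (trans (ℤ.pos-+ (count (4 + k)) _) (cong₂ _+ℤ_ count-4+k (cong +_ (fixedCorner-length-periodic k))))
  second-difference : ∀ a b x y → + 1 *ℤ ((a +ℤ b) +ℤ b) +ℤ (+ 0 *ℤ x +ℤ (-[1+ 1 ] *ℤ (a +ℤ b) +ℤ (+ 0 *ℤ y +ℤ (+ 1 *ℤ a +ℤ + 0)))) ≡ + 0
  second-difference = ℤ-Solver.solve-∀

G⁻-identity : ∀ n → mulPS (ppow (padd (pconst (+ 1)) (ppow X 2)) 2) signedCount n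
                    ≡ coeff (pmul (ppow X 3) (padd (pconst (+ 1)) (pmul (pconst (- (+ 1))) (ppow X 2)))) n
G⁻-identity 0 = refl
G⁻-identity 1 = refl
G⁻-identity 2 = refl
G⁻-identity 3 = refl
G⁻-identity 4 = refl
G⁻-identity 5 = refl
G⁻-identity (suc (suc (suc (suc (suc (suc k)))))) =
  trans (cong₂ (λ u v → + 1 *ℤ u +ℤ (+ 0 *ℤ signedCount (5 + k) +ℤ (+ 2 *ℤ v +ℤ (+ 0 *ℤ signedCount (3 + k) +ℤ (+ 1 *ℤ signedCount (2 + k) +ℤ + 0)))))
               signed-6+k signed-4+k)
        (twisted-second-difference (signedCount (2 + k)) s (signedCount (5 + k)) (signedCount (3 + k)))
  where
  s = signSum (fixedCorner (3 + k))
  signed-4+k : signedCount (4 + k) ≡ - signedCount (2 + k) +ℤ s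
  signed-4+k = signedCount-step (2 + k)
  signed-6+k : signedCount (6 + k) ≡ - (- signedCount (2 + k) +ℤ s) +ℤ - s
  signed-6+k = trans (signedCount-step (4 + k)) (cong₂ _+ℤ_ (cong -_ signed-4+k) (fixedCorner-signSum-antiperiodic k))
  twisted-second-difference : ∀ a b x y → + 1 *ℤ (- (- a +ℤ b) +ℤ - b) +ℤ (+ 0 *ℤ x +ℤ (+ 2 *ℤ (- a +ℤ b) +ℤ (+ 0 *ℤ y +ℤ (+ 1 *ℤ a +ℤ + 0)))) ≡ + 0
  twisted-second-difference = ℤ-Solver.solve-∀

mainTheorem12 : (∀ (n : ℕ) → mulPS (ppow (padd (pconst (+ 1)) (pmul (pconst (- (+ 1))) (ppow X 2))) 2) gPlus n
                               ≡ coeff (pmul (ppow X 3) (padd (pconst (+ 1)) (ppow X 2))) n)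
                × (∀ (n : ℕ) → mulPS (ppow (padd (pconst (+ 1)) (ppow X 2)) 2) gMinus n
                               ≡ coeff (pmul (ppow X 3) (padd (pconst (+ 1)) (pmul (pconst (- (+ 1))) (ppow X 2)))) n)
mainTheorem12 =
  (λ n → trans (mulPS-cong (ppow (padd (pconst (+ 1)) (pmul (pconst (- (+ 1))) (ppow X 2))) 2) gPlus≡count n) (G⁺-identity n)) ,
  (λ n → trans (mulPS-cong (ppow (padd (pconst (+ 1)) (ppow X 2)) 2) gMinus≡signedCount n) (G⁻-identity n))
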